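{- For every finite multigraph $G$ and all positive integers $x>y$, $P(G,x,y)=\xi(G,x,-1,x-y)$.
   Context: Let $X$ be a set of $x$ colors and $Y\subseteq X$ a subset of $y$ proper colors. $P(G,x,y)$ is the number of generalized colorings of $G=(V,E)$: maps $\phi:V\to X$ such that for every edge $\{u,v\}$ with $u\neq v$, if $\phi(u),\phi(v)\in Y$ then $\phi(u)\neq\phi(v)$; a vertex with a self-loop must get a color in $X\setminus Y$; multiple edges act as single edges. For $S\subseteq E$, $V(S)$ is the set of vertices covered by $S$, $k(S)$ the number of connected components of $(V,S)$, and $k_{cov}(B)$ the number of connected components of $(V(B),B)$. $\xi(G,x,y,z)=\sum_{(A,B)} x^{k(A\cup B)-k_{cov}(B)} y^{|A|+|B|-k_{cov}(B)} z^{k_{cov}(B)}$, summing over pairs $A,B\subseteq E$ with $V(A)\cap V(B)=\emptyset$ (with $0^0=1$); equivalently, $\xi$ is the function satisfying $\xi(G)=\xi(G_{ -e})+y\,\xi(G_{/e})+z\,\xi(G_{\dagger e})$ for every edge $e$ (deletion, contraction of $e$, and removal of both endpoints of $e$ with all incident edges), multiplicativity over disjoint unions, $\xi(\text{single vertex})=x$ and $\xi(\text{empty graph})=1$. -}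

module Defs where

open import Data.Nat as ℕ using (ℕ; zero; suc; _<ᵇ_)
open import Data.Bool using (Bool; true; false; _∧_; _∨_; not; if_then_else_)
open import Data.Fin using (Fin; toℕ)
open import Data.Fin.Properties using (_≟_)
open import Data.List using (List; []; _∷_; map; concatMap; length; filter; _++_; foldr)
open import Data.Bool.ListAction using (any; all)
open import Data.Vec using (Vec; []; _∷_)
open import Data.Product using (_×_; _,_; proj₁; proj₂)
open import Data.Integer as ℤ using (ℤ; +_)
open import Relation.Nullary.Decidable using (⌊_⌋; does)

-- A finite multigraph on vertex set Fin n: a list of edges (u , v).
-- Loops (u , u) and repeated edges are allowed; each list entry is a
-- distinct edge of the multiset E.
Graph : ℕ → Set
Graph n = List (Fin n × Fin n)

_==_ : ∀ {n} → Fin n → Fin n → Bool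
u == v = does (u ≟ v)

allFin : (n : ℕ) → List (Fin n)
allFin zero = []
allFin (suc n) = Data.Fin.zero ∷ map Data.Fin.suc (allFin n)

count : ∀ {A : Set} → (A → Bool) → List A → ℕ
count p xs = length (filter (λ a → Data.Bool._≟_ (p a) true) xs)

allMaps : (n x : ℕ) → List (Vec (Fin x) n)
allMaps zero x = [] ∷ []
allMaps (suc n) x = concatMap (λ c → map (c ∷_) (allMaps n x)) (allFin x)

lookup : ∀ {A : Set} {n} → Vec A n → Fin n → A
lookup = Data.Vec.lookup

-- colour c is proper (in Y) iff toℕ c < y; Y = first y colours of X = Fin x
proper : ∀ {x} → ℕ → Fin x → Bool
proper y c = toℕ c <ᵇ y

edgeOK : ∀ {n x} → ℕ → Vec (Fin x) n → Fin n × Fin n → Bool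
edgeOK y φ (u , v) =
  if u == v
  then not (proper y (lookup φ u))
  else not (proper y (lookup φ u) ∧ proper y (lookup φ v)
            ∧ (lookup φ u == lookup φ v))

isGenColoring : ∀ {n x} → ℕ → Graph n → Vec (Fin x) n → Bool
isGenColoring y E φ = all (edgeOK y φ) E

P : ∀ {n} → Graph n → ℕ → ℕ → ℕ
P {n} E x y = count (isGenColoring y E) (allMaps n x)

reach : ∀ {n} → ℕ → Graph n → Fin n → Fin n → Bool
reach zero S u v = u == v
reach (suc k) S u v =
  reach k S u v ∨
  any (λ e → (reach k S u (proj₁ e) ∧ (proj₂ e == v))
           ∨ (reach k S u (proj₂ e) ∧ (proj₁ e == v))) S

connected : ∀ {n} → Graph n → Fin n → Fin n → Bool
connected {n} S u v = reach n S u v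

isRep : ∀ {n} → Graph n → Fin n → Bool
isRep {n} S v = not (any (λ u → (toℕ u <ᵇ toℕ v) ∧ connected S u v) (allFin n))

covered : ∀ {n} → Graph n → Fin n → Bool
covered S v = any (λ e → (proj₁ e == v) ∨ (proj₂ e == v)) S

-- k(S): number of connected components of (V,S)
k : ∀ {n} → Graph n → ℕ
k {n} S = count (isRep S) (allFin n)

-- k_cov(S): number of connected components of (V(S),S)
kcov : ∀ {n} → Graph n → ℕ
kcov {n} S = count (λ v → covered S v ∧ isRep S v) (allFin n)

-- all sub-multisets of E (one for each choice of a subset of positions)
subsets : ∀ {A : Set} → List A → List (List A)
subsets [] = [] ∷ []
subsets (e ∷ es) = let r = subsets es in r ++ map (e ∷_) r

vdisjoint : ∀ {n} → Graph n → Graph n → Bool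
vdisjoint {n} A B = not (any (λ v → covered A v ∧ covered B v) (allFin n))

sumℤ : List ℤ → ℤ
sumℤ = foldr ℤ._+_ (+ 0)

-- ξ(G,x,y,z) = Σ_{A,B ⊆ E, V(A)∩V(B)=∅}
--   x^(k(A∪B) - kcov(B)) y^(|A|+|B| - kcov(B)) z^(kcov(B))
-- (both exponents are always ≥ 0, so truncated subtraction is exact;
--  ℤ._^_ satisfies i ^ 0 = 1, matching the convention 0^0 = 1)
ξterm : ∀ {n} → ℤ → ℤ → ℤ → Graph n → Graph n → ℤ
ξterm x y z A B =
  (x ℤ.^ (k (A ++ B) ℕ.∸ kcov B)) ℤ.*
  (y ℤ.^ ((length A ℕ.+ length B) ℕ.∸ kcov B)) ℤ.*
  (z ℤ.^ kcov B)

ξ : ∀ {n} → Graph n → ℤ → ℤ → ℤ → ℤ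
ξ E x y z =
  sumℤ (concatMap (λ A →
          map (λ B → ξterm x y z A B)
              (filter (λ B → Data.Bool._≟_ (vdisjoint A B) true) (subsets E)))
        (subsets E))

-- For a colouring φ and an edge e say that φ violates e if e
-- imposes a condition that φ breaks; violating e forces both ends of e to get
-- the same proper colour.  Inclusion–exclusion over the edges gives
--   P(G,x,y) = Σ_{S ⊆ E} (-1)^|S| · #{φ violating every edge of S},
-- and a colouring violates all of S iff it is constant on each component of
-- (V,S) with a proper colour on each component meeting S; hence the count is
-- x^unc(S) · y^kcov(S), where unc(S) is the number of vertices not covered by S.
-- On the other side a vertex-disjoint pair (A,B) is a split of S = A ∪ B, and
-- since k = unc + kcov and kcov is additive over vertex-disjoint unions, the
-- ξ-summand is (-1)^|S| x^unc(S) · x^kcov(A) (y-x)^kcov(B).  Every component of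
-- S lies entirely in A or in B, so summing over splits gives
--   Σ_{(A,B) vertex-disjoint split of S} a^kcov(A) b^kcov(B) = (a+b)^kcov(S),
-- which for a = x, b = y - x is y^kcov(S), matching the colouring side.
module Submission where

module Booleans where

  open import Defs
  open import Data.Nat using (zero; suc)
  open import Data.Bool using (Bool; true; false; _∧_; _∨_; not)
  open import Data.Bool.Properties using (∨-assoc)
  open import Data.Fin as F using (Fin)
  import Data.Fin.Properties as FP
  open import Data.Bool.Properties using (T-≡)
  open import Data.List using ([]; _∷_; length; _++_; filterᵇ)
  open import Data.List.Properties using (length-map)
  open import Data.List.Membership.Propositional using (_∈_)
  open import Data.List.Membership.Propositional.Properties using (∈-map⁺; ∈-filter⁺; ∈-filter⁻)
  open import Data.List.Relation.Unary.Any using (here; there)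
  open import Data.Bool.ListAction using (any; all)
  open import Data.Product using (Σ; _×_; _,_; proj₁; proj₂; map₂)
  open import Data.Sum using (_⊎_; inj₁; inj₂)
  open import Data.Empty using (⊥; ⊥-elim)
  open import Function using (Equivalence; _∘_)
  open import Relation.Nullary using (yes; no)
  open import Relation.Nullary.Decidable using (T?)
  open import Relation.Binary.PropositionalEquality

  ∨-elim : ∀ a b → a ∨ b ≡ true → a ≡ true ⊎ b ≡ true
  ∨-elim true b _ = inj₁ refl
  ∨-elim false b p = inj₂ p

  ∨-inl : ∀ {a} b → a ≡ true → a ∨ b ≡ true
  ∨-inl b refl = refl

  ∨-inr : ∀ a {b} → b ≡ true → a ∨ b ≡ true
  ∨-inr true _ = refl
  ∨-inr false p = p

  ∧-elim : ∀ a b → a ∧ b ≡ true → a ≡ true × b ≡ true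
  ∧-elim true true _ = refl , refl

  ∧-intro : ∀ {a b} → a ≡ true → b ≡ true → a ∧ b ≡ true
  ∧-intro refl refl = refl

  not-true : ∀ a → not a ≡ true → a ≡ false
  not-true false _ = refl

  not-intro : ∀ a → a ≡ false → not a ≡ true
  not-intro false _ = refl

  true≢false : ∀ {a} → a ≡ true → a ≡ false → ⊥
  true≢false refl ()

  bool-cases : ∀ a → a ≡ false ⊎ a ≡ true
  bool-cases false = inj₁ refl
  bool-cases true = inj₂ refl

  bool-ext : ∀ {a b} → (a ≡ true → b ≡ true) → (b ≡ true → a ≡ true) → a ≡ b
  bool-ext {false} {false} f g = refl
  bool-ext {false} {true} f g = g refl
  bool-ext {true} {false} f g = sym (f refl)
  bool-ext {true} {true} f g = refl

  any-elim : ∀ {A : Set} (p : A → Bool) xs → any p xs ≡ true → Σ A λ x → x ∈ xs × p x ≡ true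
  any-elim p (x ∷ xs) h with ∨-elim (p x) (any p xs) h
  ... | inj₁ q = x , here refl , q
  ... | inj₂ q with any-elim p xs q
  ... | y , m , r = y , there m , r

  any-intro : ∀ {A : Set} (p : A → Bool) {x} xs → x ∈ xs → p x ≡ true → any p xs ≡ true
  any-intro p (y ∷ xs) (here refl) q = ∨-inl (any p xs) q
  any-intro p (y ∷ xs) (there m) q = ∨-inr (p y) (any-intro p xs m q)

  any-false : ∀ {A : Set} (p : A → Bool) xs → (∀ {x} → x ∈ xs → p x ≡ false) → any p xs ≡ false
  any-false p [] h = refl
  any-false p (x ∷ xs) h rewrite h (here refl) = any-false p xs (λ m → h (there m))

  all-elim : ∀ {A : Set} (p : A → Bool) {x} xs → all p xs ≡ true → x ∈ xs → p x ≡ true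
  all-elim p (y ∷ xs) h (here refl) = proj₁ (∧-elim (p y) _ h)
  all-elim p (y ∷ xs) h (there m) = all-elim p xs (proj₂ (∧-elim (p y) _ h)) m

  all-intro : ∀ {A : Set} (p : A → Bool) xs → (∀ {x} → x ∈ xs → p x ≡ true) → all p xs ≡ true
  all-intro p [] h = refl
  all-intro p (y ∷ xs) h = ∧-intro (h (here refl)) (all-intro p xs (λ m → h (there m)))

  all-or-counterexample : ∀ {A : Set} (p : A → Bool) xs →
    (∀ {x} → x ∈ xs → p x ≡ true) ⊎ Σ A λ x → x ∈ xs × p x ≡ false
  all-or-counterexample p [] = inj₁ (λ ())
  all-or-counterexample p (x ∷ xs) with bool-cases (p x)
  ... | inj₁ f = inj₂ (x , here refl , f)
  ... | inj₂ t with all-or-counterexample p xs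
  ... | inj₁ a = inj₁ λ { (here refl) → t ; (there m) → a m }
  ... | inj₂ (y , m , f) = inj₂ (y , there m , f)

  any-cong : ∀ {A : Set} {p q : A → Bool} xs → (∀ x → p x ≡ q x) → any p xs ≡ any q xs
  any-cong [] h = refl
  any-cong (x ∷ xs) h = cong₂ _∨_ (h x) (any-cong xs h)

  any-++ : ∀ {A : Set} (p : A → Bool) xs ys → any p (xs ++ ys) ≡ any p xs ∨ any p ys
  any-++ p [] ys = refl
  any-++ p (x ∷ xs) ys rewrite any-++ p xs ys = sym (∨-assoc (p x) _ _)

  ==-sound : ∀ {n} {u v : Fin n} → (u == v) ≡ true → u ≡ v
  ==-sound {u = u} {v} h with u FP.≟ v
  ... | yes e = e
  ==-sound {u = u} {v} () | no _

  ==-refl : ∀ {n} (u : Fin n) → (u == u) ≡ true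
  ==-refl u with u FP.≟ u
  ... | yes _ = refl
  ... | no ne = ⊥-elim (ne refl)

  ==-intro : ∀ {n} {u v : Fin n} → u ≡ v → (u == v) ≡ true
  ==-intro {u = u} refl = ==-refl u

  filterᵇ-∈ : ∀ {T : Set} (p : T → Bool) xs {x} → x ∈ filterᵇ p xs → x ∈ xs × p x ≡ true
  filterᵇ-∈ p xs m = map₂ (Equivalence.to T-≡) (∈-filter⁻ (T? ∘ p) {xs = xs} m)

  filterᵇ-intro : ∀ {T : Set} (p : T → Bool) xs {x} → x ∈ xs → p x ≡ true → x ∈ filterᵇ p xs
  filterᵇ-intro p xs m px = ∈-filter⁺ (T? ∘ p) m (Equivalence.from T-≡ px)

  allFin-∈ : ∀ n (v : Fin n) → v ∈ allFin n
  allFin-∈ (suc n) F.zero = here refl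
  allFin-∈ (suc n) (F.suc v) = there (∈-map⁺ F.suc (allFin-∈ n v))

  allFin-length : ∀ n → length (allFin n) ≡ n
  allFin-length zero = refl
  allFin-length (suc n) = cong suc (trans (length-map F.suc (allFin n)) (allFin-length n))

module Tallies where

  open import Defs
  open Booleans
  open import Data.Nat using (ℕ; zero; suc; _≤_; z≤n; s≤s; _+_; _*_)
  import Data.Nat.Properties as ℕP
  open import Algebra.Properties.CommutativeSemigroup ℕP.+-commutativeSemigroup using (interchange)
  open import Data.Bool using (Bool; true; false; _∧_)
  open import Data.Fin as F using (Fin)
  import Data.Fin.Properties as FP
  open import Data.List using (List; []; _∷_; map; length; _++_; concatMap)
  open import Data.List.Membership.Propositional using (_∈_)
  open import Data.List.Relation.Unary.Any using (here; there)
  open import Relation.Binary.PropositionalEquality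

  ind : Bool → ℕ
  ind true = 1
  ind false = 0

  sumN : ∀ {A : Set} → (A → ℕ) → List A → ℕ
  sumN f [] = 0
  sumN f (x ∷ xs) = f x + sumN f xs

  tally : ∀ {A : Set} → (A → Bool) → List A → ℕ
  tally p xs = sumN (λ x → ind (p x)) xs

  count≡tally : ∀ {A : Set} (p : A → Bool) xs → count p xs ≡ tally p xs
  count≡tally p [] = refl
  count≡tally p (x ∷ xs) with p x
  ... | true = cong suc (count≡tally p xs)
  ... | false = count≡tally p xs

  sumN-cong : ∀ {A : Set} {f g : A → ℕ} xs → (∀ x → f x ≡ g x) → sumN f xs ≡ sumN g xs
  sumN-cong [] h = refl
  sumN-cong (x ∷ xs) h = cong₂ _+_ (h x) (sumN-cong xs h)

  sumN-0 : ∀ {A : Set} xs → sumN (λ (_ : A) → 0) xs ≡ 0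
  sumN-0 [] = refl
  sumN-0 (x ∷ xs) = sumN-0 xs

  sumN-+ : ∀ {A : Set} (f g : A → ℕ) xs → sumN (λ x → f x + g x) xs ≡ sumN f xs + sumN g xs
  sumN-+ f g [] = refl
  sumN-+ f g (x ∷ xs) rewrite sumN-+ f g xs = interchange (f x) (g x) (sumN f xs) (sumN g xs)

  sumN-*r : ∀ {A : Set} c (f : A → ℕ) xs → sumN (λ x → f x * c) xs ≡ sumN f xs * c
  sumN-*r c f [] = refl
  sumN-*r c f (x ∷ xs) rewrite sumN-*r c f xs = sym (ℕP.*-distribʳ-+ c (f x) _)

  sumN-*l : ∀ {A : Set} c (f : A → ℕ) xs → sumN (λ x → c * f x) xs ≡ c * sumN f xs
  sumN-*l c f [] = sym (ℕP.*-zeroʳ c)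
  sumN-*l c f (x ∷ xs) rewrite sumN-*l c f xs = sym (ℕP.*-distribˡ-+ c (f x) _)

  sumN-map : ∀ {A B : Set} (f : B → ℕ) (g : A → B) xs → sumN f (map g xs) ≡ sumN (λ x → f (g x)) xs
  sumN-map f g [] = refl
  sumN-map f g (x ∷ xs) = cong (f (g x) +_) (sumN-map f g xs)

  sumN-++ : ∀ {A : Set} (f : A → ℕ) xs ys → sumN f (xs ++ ys) ≡ sumN f xs + sumN f ys
  sumN-++ f [] ys = refl
  sumN-++ f (x ∷ xs) ys rewrite sumN-++ f xs ys = sym (ℕP.+-assoc (f x) _ _)

  sumN-concatMap : ∀ {A B : Set} (f : B → ℕ) (g : A → List B) xs →
                   sumN f (concatMap g xs) ≡ sumN (λ x → sumN f (g x)) xs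
  sumN-concatMap f g [] = refl
  sumN-concatMap f g (x ∷ xs) =
    trans (sumN-++ f (g x) (concatMap g xs)) (cong (sumN f (g x) +_) (sumN-concatMap f g xs))

  sumN-swap : ∀ {A B : Set} (f : A → B → ℕ) xs ys →
              sumN (λ x → sumN (λ y → f x y) ys) xs ≡ sumN (λ y → sumN (λ x → f x y) xs) ys
  sumN-swap f [] ys = sym (sumN-0 ys)
  sumN-swap f (x ∷ xs) ys rewrite sumN-swap f xs ys = sym (sumN-+ (f x) (λ y → sumN (λ x → f x y) xs) ys)

  tally-cong : ∀ {A : Set} {p q : A → Bool} xs → (∀ x → p x ≡ q x) → tally p xs ≡ tally q xs
  tally-cong xs h = sumN-cong xs (λ x → cong ind (h x))

  ind-∧ : ∀ a b → ind (a ∧ b) ≡ ind a * ind b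
  ind-∧ true b = sym (ℕP.+-identityʳ (ind b))
  ind-∧ false b = refl

  tally-∧ : ∀ {A : Set} a (q : A → Bool) xs → tally (λ x → a ∧ q x) xs ≡ ind a * tally q xs
  tally-∧ a q xs = trans (sumN-cong xs (λ x → ind-∧ a (q x))) (sumN-*l (ind a) (λ x → ind (q x)) xs)

  ind-mono : ∀ {a b} → (a ≡ true → b ≡ true) → ind a ≤ ind b
  ind-mono {false} h = z≤n
  ind-mono {true} h rewrite h refl = s≤s z≤n

  tally-mono : ∀ {A : Set} (p q : A → Bool) xs → (∀ x → p x ≡ true → q x ≡ true) → tally p xs ≤ tally q xs
  tally-mono p q [] h = z≤n
  tally-mono p q (x ∷ xs) h = ℕP.+-mono-≤ (ind-mono (h x)) (tally-mono p q xs h)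

  tally-strict : ∀ {A : Set} (p q : A → Bool) xs → (∀ x → p x ≡ true → q x ≡ true) →
                 ∀ {y} → y ∈ xs → q y ≡ true → p y ≡ false → suc (tally p xs) ≤ tally q xs
  tally-strict p q (x ∷ xs) h (here refl) qy py rewrite qy | py = s≤s (tally-mono p q xs h)
  tally-strict p q (x ∷ xs) h (there m) qy py =
    ℕP.≤-trans (ℕP.≤-reflexive (sym (ℕP.+-suc (ind (p x)) _)))
      (ℕP.+-mono-≤ (ind-mono (h x)) (tally-strict p q xs h m qy py))

  tally-pos : ∀ {A : Set} (p : A → Bool) xs {y} → y ∈ xs → p y ≡ true → 1 ≤ tally p xs
  tally-pos p xs m py = ℕP.≤-trans (s≤s z≤n) (tally-strict (λ _ → false) p xs (λ _ ()) m py refl)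

  tally≤length : ∀ {A : Set} (p : A → Bool) xs → tally p xs ≤ length xs
  tally≤length p [] = z≤n
  tally≤length p (x ∷ xs) = ℕP.+-mono-≤ (ind≤1 (p x)) (tally≤length p xs)
    where ind≤1 : ∀ b → ind b ≤ 1
          ind≤1 false = z≤n
          ind≤1 true = s≤s z≤n

  tally-single : ∀ n (ρ : Fin n) → tally (λ v → v == ρ) (allFin n) ≡ 1
  tally-single (suc n) F.zero =
    cong suc (trans (sumN-map (λ v → ind (v == F.zero)) F.suc (allFin n)) (never-zero (allFin n)))
    where never-zero : ∀ xs → sumN (λ v → ind (F.suc v == F.zero)) xs ≡ 0
          never-zero [] = refl
          never-zero (x ∷ xs) = never-zero xs
  tally-single (suc n) (F.suc ρ) = trans (sumN-map (λ v → ind (v == F.suc ρ)) F.suc (allFin n))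
    (trans (sumN-cong (allFin n) (λ v → cong ind (==-suc v ρ))) (tally-single n ρ))
    where ==-suc : ∀ {n} (a b : Fin n) → (F.suc a == F.suc b) ≡ (a == b)
          ==-suc a b = bool-ext (λ h → ==-intro (FP.suc-injective (==-sound {u = F.suc a} {v = F.suc b} h)))
                                (λ h → ==-intro (cong F.suc (==-sound {u = a} {v = b} h)))

  prodN : ∀ {A : Set} → (A → ℕ) → List A → ℕ
  prodN f [] = 1
  prodN f (x ∷ xs) = f x * prodN f xs

  prodN-map : ∀ {A B : Set} (f : B → ℕ) (g : A → B) xs → prodN f (map g xs) ≡ prodN (λ x → f (g x)) xs
  prodN-map f g [] = refl
  prodN-map f g (x ∷ xs) = cong (f (g x) *_) (prodN-map f g xs)

  prodN-cong : ∀ {A : Set} {f g : A → ℕ} xs → (∀ x → f x ≡ g x) → prodN f xs ≡ prodN g xs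
  prodN-cong [] h = refl
  prodN-cong (x ∷ xs) h = cong₂ _*_ (h x) (prodN-cong xs h)

module Walks where

  open import Defs
  open Booleans
  open import Data.List.Relation.Binary.Subset.Propositional using (_⊆_)
  open import Data.Nat using (ℕ; zero; suc; _≤_; _+_; _∸_)
  import Data.Nat.Properties as ℕP
  open import Data.Bool using (Bool; true; _∧_; _∨_)
  open import Data.Fin using (Fin)
  open import Data.List.Membership.Propositional using (_∈_)
  open import Data.Product using (Σ; _×_; _,_; proj₁; proj₂)
  open import Data.Sum using (_⊎_; inj₁; inj₂)
  open import Data.Empty using (⊥-elim)
  open import Relation.Nullary using (¬_)
  open import Relation.Binary.PropositionalEquality

  Reaches : ∀ {n} → ℕ → Graph n → Fin n → Fin n → Set
  Reaches j S u v = reach j S u v ≡ true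

  module _ {n : ℕ} (S : Graph n) where

    stepTest : ℕ → Fin n → Fin n → Fin n × Fin n → Bool
    stepTest j u v e = (reach j S u (proj₁ e) ∧ (proj₂ e == v)) ∨ (reach j S u (proj₂ e) ∧ (proj₁ e == v))

    LastStep : ℕ → Fin n → Fin n → Set
    LastStep j u v = Σ (Fin n × Fin n) λ e → e ∈ S ×
      ((Reaches j S u (proj₁ e) × proj₂ e ≡ v) ⊎ (Reaches j S u (proj₂ e) × proj₁ e ≡ v))

    reach-suc-inv : ∀ j u v → Reaches (suc j) S u v → Reaches j S u v ⊎ LastStep j u v
    reach-suc-inv j u v h with ∨-elim (reach j S u v) _ h
    ... | inj₁ q = inj₁ q
    ... | inj₂ q with any-elim (stepTest j u v) S q
    ... | e , m , r with ∨-elim (reach j S u (proj₁ e) ∧ (proj₂ e == v)) _ r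
    ... | inj₁ r1 = let (a , b) = ∧-elim _ _ r1 in inj₂ (e , m , inj₁ (a , ==-sound {u = proj₂ e} {v = v} b))
    ... | inj₂ r2 = let (a , b) = ∧-elim _ _ r2 in inj₂ (e , m , inj₂ (a , ==-sound {u = proj₁ e} {v = v} b))

    reach-suc : ∀ j u v → Reaches j S u v → Reaches (suc j) S u v
    reach-suc j u v h = ∨-inl _ h

    reach-extend⃗ : ∀ j u e → e ∈ S → Reaches j S u (proj₁ e) → Reaches (suc j) S u (proj₂ e)
    reach-extend⃗ j u e m h = ∨-inr (reach j S u (proj₂ e))
      (any-intro (stepTest j u (proj₂ e)) S m (∨-inl _ (∧-intro h (==-refl (proj₂ e)))))

    reach-extend⃖ : ∀ j u e → e ∈ S → Reaches j S u (proj₂ e) → Reaches (suc j) S u (proj₁ e)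
    reach-extend⃖ j u e m h = ∨-inr (reach j S u (proj₁ e))
      (any-intro (stepTest j u (proj₁ e)) S m
        (∨-inr (reach j S u (proj₁ e) ∧ (proj₂ e == proj₁ e)) (∧-intro h (==-refl (proj₁ e)))))

    reach-here : ∀ u → Reaches 0 S u u
    reach-here u = ==-refl u

    reach-zero-inv : ∀ {u v} → Reaches 0 S u v → u ≡ v
    reach-zero-inv {u} {v} h = ==-sound {u = u} {v = v} h

    reach-+ : ∀ {j u v} m → Reaches j S u v → Reaches (m + j) S u v
    reach-+ zero h = h
    reach-+ {j} {u} {v} (suc m) h = reach-suc (m + j) u v (reach-+ m h)

    reach-mono : ∀ {j m u v} → j ≤ m → Reaches j S u v → Reaches m S u v
    reach-mono {j} {m} le h = subst (λ t → Reaches t S _ _) (ℕP.m∸n+n≡m le) (reach-+ (m ∸ j) h)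

    reach-concat : ∀ {j u w} m {v} → Reaches j S u w → Reaches m S w v → Reaches (j + m) S u v
    reach-concat {j} {u} {w} zero {v} h1 h2 rewrite ℕP.+-identityʳ j =
      subst (Reaches j S u) (reach-zero-inv {w} {v} h2) h1
    reach-concat {j} {u} {w} (suc m) {v} h1 h2 rewrite ℕP.+-suc j m with reach-suc-inv m w v h2
    ... | inj₁ q = reach-suc (j + m) u v (reach-concat {j} {u} {w} m h1 q)
    ... | inj₂ (e , me , inj₁ (q , refl)) = reach-extend⃗ (j + m) u e me (reach-concat {j} {u} {w} m h1 q)
    ... | inj₂ (e , me , inj₂ (q , refl)) = reach-extend⃖ (j + m) u e me (reach-concat {j} {u} {w} m h1 q)

    reach-sym : ∀ j {u v} → Reaches j S u v → Reaches j S v u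
    reach-sym zero {u} {v} h = subst (λ t → Reaches 0 S t u) (reach-zero-inv {u} {v} h) (reach-here u)
    reach-sym (suc j) {u} {v} h with reach-suc-inv j u v h
    ... | inj₁ q = reach-suc j v u (reach-sym j q)
    ... | inj₂ (e , me , inj₁ (q , refl)) =
      reach-concat {1} {proj₂ e} {proj₁ e} j (reach-extend⃖ 0 (proj₂ e) e me (reach-here (proj₂ e))) (reach-sym j q)
    ... | inj₂ (e , me , inj₂ (q , refl)) =
      reach-concat {1} {proj₁ e} {proj₂ e} j (reach-extend⃗ 0 (proj₁ e) e me (reach-here (proj₁ e))) (reach-sym j q)

    covered-src : ∀ {e} → e ∈ S → covered S (proj₁ e) ≡ true
    covered-src {e} m = any-intro (λ e' → (proj₁ e' == proj₁ e) ∨ (proj₂ e' == proj₁ e)) S m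
      (∨-inl (proj₂ e == proj₁ e) (==-refl (proj₁ e)))

    covered-tgt : ∀ {e} → e ∈ S → covered S (proj₂ e) ≡ true
    covered-tgt {e} m = any-intro (λ e' → (proj₁ e' == proj₂ e) ∨ (proj₂ e' == proj₂ e)) S m
      (∨-inr (proj₁ e == proj₂ e) (==-refl (proj₂ e)))

    covered-inv : ∀ v → covered S v ≡ true → Σ (Fin n × Fin n) λ e → e ∈ S × (proj₁ e ≡ v ⊎ proj₂ e ≡ v)
    covered-inv v h with any-elim _ S h
    ... | e , m , q with ∨-elim _ _ q
    ... | inj₁ a = e , m , inj₁ (==-sound {u = proj₁ e} {v = v} a)
    ... | inj₂ b = e , m , inj₂ (==-sound {u = proj₂ e} {v = v} b)

    reach-covered : ∀ j {u v} → Reaches j S u v → ¬ u ≡ v → covered S v ≡ true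
    reach-covered zero {u} {v} h ne = ⊥-elim (ne (reach-zero-inv {u} {v} h))
    reach-covered (suc j) {u} {v} h ne with reach-suc-inv j u v h
    ... | inj₁ q = reach-covered j q ne
    ... | inj₂ (e , me , inj₁ (q , refl)) = covered-tgt me
    ... | inj₂ (e , me , inj₂ (q , refl)) = covered-src me

    reach-invariant : ∀ {A : Set} (φ : Fin n → A) → (∀ {e} → e ∈ S → φ (proj₁ e) ≡ φ (proj₂ e)) →
                      ∀ j {u v} → Reaches j S u v → φ u ≡ φ v
    reach-invariant φ c zero {u} {v} h = cong φ (reach-zero-inv {u} {v} h)
    reach-invariant φ c (suc j) {u} {v} h with reach-suc-inv j u v h
    ... | inj₁ q = reach-invariant φ c j q
    ... | inj₂ (e , me , inj₁ (q , refl)) = trans (reach-invariant φ c j q) (c me)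
    ... | inj₂ (e , me , inj₂ (q , refl)) = trans (reach-invariant φ c j q) (sym (c me))

  reach-subgraph : ∀ {n} {S S' : Graph n} → S ⊆ S' → ∀ j {u v} → Reaches j S u v → Reaches j S' u v
  reach-subgraph sub zero h = h
  reach-subgraph {S = S} {S'} sub (suc j) {u} {v} h with reach-suc-inv S j u v h
  ... | inj₁ q = reach-suc S' j u v (reach-subgraph sub j q)
  ... | inj₂ (e , me , inj₁ (q , refl)) = reach-extend⃗ S' j u e (sub me) (reach-subgraph sub j q)
  ... | inj₂ (e , me , inj₂ (q , refl)) = reach-extend⃖ S' j u e (sub me) (reach-subgraph sub j q)

  covered-subgraph : ∀ {n} {S S' : Graph n} → S ⊆ S' → ∀ v → covered S v ≡ true → covered S' v ≡ true
  covered-subgraph {S = S} {S'} sub v h with covered-inv S v h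
  ... | e , m , inj₁ refl = covered-src S' (sub m)
  ... | e , m , inj₂ refl = covered-tgt S' (sub m)

-- As long as the j-ball of u keeps growing its size
-- exceeds j, which is impossible past n; once it stops growing it is constant.
module Connectivity where

  open import Defs
  open Booleans
  open Tallies
  open Walks
  open import Data.List.Relation.Binary.Subset.Propositional using (_⊆_)
  open import Data.Nat using (ℕ; zero; suc; _≤_; z≤n; s≤s; _+_; _∸_)
  import Data.Nat.Properties as ℕP
  open import Data.Bool using (Bool; true; false; _∧_; _∨_; not)
  open import Data.Fin using (Fin)
  open import Data.List.Membership.Propositional using (_∈_)
  open import Data.Bool.ListAction using (any)
  open import Data.Product using (Σ; _×_; _,_; proj₁; proj₂)
  open import Data.Sum using (_⊎_; inj₁; inj₂)
  open import Data.Empty using (⊥-elim)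
  open import Relation.Nullary using (¬_; yes; no)
  open import Relation.Binary.PropositionalEquality

  module _ {n : ℕ} (S : Graph n) (u : Fin n) where

    grow : (Fin n → Bool) → Fin n → Bool
    grow F v = F v ∨ any (λ e → (F (proj₁ e) ∧ (proj₂ e == v)) ∨ (F (proj₂ e) ∧ (proj₁ e == v))) S

    grow-cong : ∀ {F G} → (∀ v → F v ≡ G v) → ∀ v → grow F v ≡ grow G v
    grow-cong h v = cong₂ _∨_ (h v) (any-cong S (λ e →
      cong₂ _∨_ (cong (_∧ (proj₂ e == v)) (h (proj₁ e))) (cong (_∧ (proj₁ e == v)) (h (proj₂ e)))))

    Stable : ℕ → Set
    Stable j = ∀ v → reach (suc j) S u v ≡ reach j S u v

    stable-forever : ∀ j → Stable j → ∀ m v → reach (m + j) S u v ≡ reach j S u v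
    stable-forever j st zero v = refl
    stable-forever j st (suc m) v = trans (grow-cong (stable-forever j st m) v) (st v)

    ballSize : ℕ → ℕ
    ballSize j = tally (reach j S u) (allFin n)

    stable-or-grows : ∀ j → Stable j ⊎ Σ (Fin n) λ v → reach (suc j) S u v ≡ true × reach j S u v ≡ false
    stable-or-grows j with all-or-counterexample (λ v → not (reach (suc j) S u v) ∨ reach j S u v) (allFin n)
    ... | inj₁ noNew = inj₁ λ v → bool-ext
          (λ h → modus-ponens (reach (suc j) S u v) (reach j S u v) h (noNew (allFin-∈ n v)))
          (reach-suc S j u v)
      where modus-ponens : ∀ a b → a ≡ true → not a ∨ b ≡ true → b ≡ true
            modus-ponens true b refl q = q
    ... | inj₂ (v , _ , new) = inj₂ (v , counterexample (reach (suc j) S u v) (reach j S u v) new)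
      where counterexample : ∀ a b → not a ∨ b ≡ false → a ≡ true × b ≡ false
            counterexample true false refl = refl , refl

    stable-or-large : ∀ j → (Σ ℕ λ i → i ≤ j × Stable i) ⊎ (suc j ≤ ballSize j)
    stable-or-large zero = inj₂ (tally-pos (reach 0 S u) (allFin n) (allFin-∈ n u) (reach-here S u))
    stable-or-large (suc j) with stable-or-large j
    ... | inj₁ (i , le , st) = inj₁ (i , ℕP.m≤n⇒m≤1+n le , st)
    ... | inj₂ large with stable-or-grows j
    ... | inj₁ st = inj₁ (j , ℕP.n≤1+n j , st)
    ... | inj₂ (v , t , f) = inj₂ (ℕP.≤-trans (s≤s large)
            (tally-strict (reach j S u) (reach (suc j) S u) (allFin n) (λ w → reach-suc S j u w) (allFin-∈ n v) t f))

    stable-by-n : Σ ℕ λ i → i ≤ n × Stable i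
    stable-by-n with stable-or-large n
    ... | inj₁ st = st
    ... | inj₂ large = ⊥-elim (ℕP.<-irrefl refl (ℕP.≤-trans large
            (ℕP.≤-trans (tally≤length (reach n S u) (allFin n)) (ℕP.≤-reflexive (allFin-length n)))))

    reach-saturates : ∀ m {v} → Reaches m S u v → Reaches n S u v
    reach-saturates m {v} h with stable-by-n | m ℕP.≤? n
    ... | _ | yes m≤n = reach-mono S {m} {n} {u} {v} m≤n h
    ... | i , i≤n , st | no m≰n = reach-mono S {i} {n} {u} {v} i≤n (trans (sym reach-m≡reach-i) h)
      where
      i≤m = ℕP.≤-trans i≤n (ℕP.<⇒≤ (ℕP.≰⇒> m≰n))
      reach-m≡reach-i : reach m S u v ≡ reach i S u v
      reach-m≡reach-i = trans (cong (λ t → reach t S u v) (sym (ℕP.m∸n+n≡m i≤m))) (stable-forever i st (m ∸ i) v)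

  Conn : ∀ {n} → Graph n → Fin n → Fin n → Set
  Conn S u v = connected S u v ≡ true

  conn-refl : ∀ {n} (S : Graph n) u → Conn S u u
  conn-refl {n} S u = reach-mono S {0} {n} {u} {u} z≤n (reach-here S u)

  conn-sym : ∀ {n} (S : Graph n) {u v} → Conn S u v → Conn S v u
  conn-sym {n} S h = reach-sym S n h

  conn-trans : ∀ {n} (S : Graph n) {u w v} → Conn S u w → Conn S w v → Conn S u v
  conn-trans {n} S {u} {w} {v} h1 h2 = reach-saturates S u (n + n) (reach-concat S {n} {u} {w} n h1 h2)

  conn-edge : ∀ {n} (S : Graph n) {e} → e ∈ S → Conn S (proj₁ e) (proj₂ e)
  conn-edge {suc n} S {e} m =
    reach-mono S {1} {suc n} {proj₁ e} {proj₂ e} (s≤s z≤n) (reach-extend⃗ S 0 (proj₁ e) e m (reach-here S (proj₁ e)))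

  conn-cov : ∀ {n} (S : Graph n) {u v} → Conn S u v → ¬ u ≡ v → covered S v ≡ true
  conn-cov {n} S h ne = reach-covered S n h ne

  conn-const : ∀ {n} (S : Graph n) {A : Set} (φ : Fin n → A) → (∀ {e} → e ∈ S → φ (proj₁ e) ≡ φ (proj₂ e)) →
               ∀ {u v} → Conn S u v → φ u ≡ φ v
  conn-const {n} S φ c h = reach-invariant S φ c n h

  conn-sub : ∀ {n} {S S' : Graph n} → S ⊆ S' → ∀ {u v} → Conn S u v → Conn S' u v
  conn-sub {n} sub h = reach-subgraph sub n h

-- The map repOf
-- is constant on components, which makes it the natural "collapse each
-- component to one vertex" map used when counting colourings.
module Representatives where

  open import Defs
  open Booleans
  open Connectivity
  open import Data.Nat using (ℕ; suc; _<_; _≤_; s≤s; _<ᵇ_)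
  import Data.Nat.Properties as ℕP
  open import Data.Bool using (Bool; true; false; _∧_)
  open import Data.Bool.Properties using (T-≡)
  open import Data.Fin as F using (Fin; toℕ)
  import Data.Fin.Properties as FP
  open import Data.Maybe using (Maybe; just; nothing)
  open import Data.Maybe.Properties using (just-injective)
  open import Data.Product using (Σ; _×_; _,_; proj₁; proj₂)
  open import Data.Sum using (inj₁; inj₂)
  open import Data.Empty using (⊥-elim)
  open import Function using (Equivalence)
  open import Relation.Nullary using (yes; no)
  open import Relation.Binary.PropositionalEquality

  <ᵇ-intro : ∀ {m n} → m < n → (m <ᵇ n) ≡ true
  <ᵇ-intro lt = Equivalence.to T-≡ (ℕP.<⇒<ᵇ lt)

  <ᵇ-elim : ∀ m n → (m <ᵇ n) ≡ true → m < n
  <ᵇ-elim m n h = ℕP.<ᵇ⇒< m n (Equivalence.from T-≡ h)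

  isRep-elim : ∀ {n} (S : Graph n) v → isRep S v ≡ true → ∀ u → toℕ u < toℕ v → connected S u v ≡ false
  isRep-elim {n} S v h u lt with bool-cases (connected S u v)
  ... | inj₁ f = f
  ... | inj₂ t = ⊥-elim (true≢false
      (any-intro (λ u → (toℕ u <ᵇ toℕ v) ∧ connected S u v) (allFin n) (allFin-∈ n u) (∧-intro (<ᵇ-intro lt) t))
      (not-true _ h))

  isRep-intro : ∀ {n} (S : Graph n) v → (∀ u → toℕ u < toℕ v → connected S u v ≡ false) → isRep S v ≡ true
  isRep-intro {n} S v h = not-intro _ (any-false _ (allFin n) λ {u} _ → smaller-unconnected u)
    where smaller-unconnected : ∀ u → ((toℕ u <ᵇ toℕ v) ∧ connected S u v) ≡ false
          smaller-unconnected u with bool-cases (toℕ u <ᵇ toℕ v)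
          ... | inj₁ f rewrite f = refl
          ... | inj₂ t rewrite t = h u (<ᵇ-elim _ _ t)

  least : ∀ {n} → (Fin n → Bool) → Maybe (Fin n)
  least {0} p = nothing
  least {suc n} p = select (p F.zero) (least (λ w → p (F.suc w)))
    where select : Bool → Maybe (Fin n) → Maybe (Fin (suc n))
          select true _ = just F.zero
          select false nothing = nothing
          select false (just w) = just (F.suc w)

  least-cong : ∀ {n} {p q : Fin n → Bool} → (∀ w → p w ≡ q w) → least p ≡ least q
  least-cong {0} h = refl
  least-cong {suc n} {p} {q} h
    rewrite h F.zero | least-cong {n} {λ w → p (F.suc w)} {λ w → q (F.suc w)} (λ w → h (F.suc w)) = refl

  least-sound : ∀ {n} (p : Fin n → Bool) u → least p ≡ just u → p u ≡ true × (∀ w → toℕ w < toℕ u → p w ≡ false)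
  least-sound {suc n} p u h with p F.zero in eq0
  least-sound {suc n} p .F.zero refl | true = eq0 , λ w ()
  ... | false with least (λ w → p (F.suc w)) in eq1
  least-sound {suc n} p .(F.suc w) refl | false | just w =
    let (pw , below) = least-sound (λ w → p (F.suc w)) w eq1 in
    pw , λ { F.zero _ → eq0 ; (F.suc w') (s≤s lt) → below w' lt }

  least-complete : ∀ {n} (p : Fin n → Bool) w → p w ≡ true → Σ (Fin n) λ u → least p ≡ just u
  least-complete {suc n} p w h with p F.zero in eq0
  ... | true = F.zero , refl
  ... | false with least (λ w → p (F.suc w)) in eq1
  ... | just u = F.suc u , refl
  least-complete {suc n} p F.zero h | false | nothing = ⊥-elim (true≢false h eq0)
  least-complete {suc n} p (F.suc w) h | false | nothing with least-complete (λ w → p (F.suc w)) w h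
  ... | u , e with () ← trans (sym eq1) e

  module Rep {n : ℕ} (S : Graph n) where

    connectedTo : Fin n → Fin n → Bool
    connectedTo v u = connected S u v

    repOf-spec : ∀ v → Σ (Fin n) λ u → least (connectedTo v) ≡ just u
    repOf-spec v = least-complete (connectedTo v) v (conn-refl S v)

    repOf : Fin n → Fin n
    repOf v = proj₁ (repOf-spec v)

    repOf-conn : ∀ v → Conn S (repOf v) v
    repOf-conn v = proj₁ (least-sound (connectedTo v) (repOf v) (proj₂ (repOf-spec v)))

    repOf-min : ∀ v w → toℕ w < toℕ (repOf v) → connected S w v ≡ false
    repOf-min v = proj₂ (least-sound (connectedTo v) (repOf v) (proj₂ (repOf-spec v)))

    repOf-cong : ∀ {u v} → Conn S u v → repOf u ≡ repOf v
    repOf-cong {u} {v} h =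
      just-injective (trans (sym (proj₂ (repOf-spec u))) (trans (least-cong same-component) (proj₂ (repOf-spec v))))
      where same-component : ∀ w → connectedTo u w ≡ connectedTo v w
            same-component w = bool-ext (λ a → conn-trans S a h) (λ b → conn-trans S b (conn-sym S h))

    repOf-≤ : ∀ v → toℕ (repOf v) ≤ toℕ v
    repOf-≤ v with toℕ (repOf v) ℕP.≤? toℕ v
    ... | yes le = le
    ... | no nle = ⊥-elim (true≢false (conn-refl S v) (repOf-min v v (ℕP.≰⇒> nle)))

    isRep⇒repOf : ∀ v → isRep S v ≡ true → repOf v ≡ v
    isRep⇒repOf v h with toℕ (repOf v) ℕP.≟ toℕ v
    ... | yes e = FP.toℕ-injective e
    ... | no ne = ⊥-elim (true≢false (repOf-conn v) (isRep-elim S v h (repOf v) (ℕP.≤∧≢⇒< (repOf-≤ v) ne)))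

    repOf⇒isRep : ∀ v → repOf v ≡ v → isRep S v ≡ true
    repOf⇒isRep v e = isRep-intro S v λ u lt → repOf-min v u (subst (λ t → toℕ u < toℕ t) (sym e) lt)

    isRep-repOf : ∀ v → isRep S (repOf v) ≡ true
    isRep-repOf v = repOf⇒isRep (repOf v) (repOf-cong (repOf-conn v))

    uncovered⇒isRep : ∀ v → covered S v ≡ false → isRep S v ≡ true
    uncovered⇒isRep v h = isRep-intro S v λ u lt → unconnected u lt
      where unconnected : ∀ u → toℕ u < toℕ v → connected S u v ≡ false
            unconnected u lt with bool-cases (connected S u v)
            ... | inj₁ f = f
            ... | inj₂ t = ⊥-elim (true≢false (conn-cov S t (λ e → ℕP.<-irrefl (cong toℕ e) lt)) h)

    repOf-covered : ∀ v → covered S v ≡ true → covered S (repOf v) ≡ true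
    repOf-covered v h with repOf v FP.≟ v
    ... | yes e = subst (λ t → covered S t ≡ true) (sym e) h
    ... | no ne = conn-cov S (conn-sym S (repOf-conn v)) (λ e → ne (sym e))

-- They depend only on the set of edges
-- (not on order or multiplicity), satisfy k = unc + kcov, and kcov is
-- additive over vertex-disjoint unions: a component of A ++ B inside V(A) is
-- a component of A, because a walk starting in V(A) never leaves A.
module ComponentCounts where

  open import Defs
  open Booleans
  open Tallies
  open Walks
  open Connectivity
  open Representatives
  open import Data.Nat using (ℕ; zero; suc; _+_; _<ᵇ_)
  import Data.Nat.Properties as ℕP
  open import Data.Bool using (true; false; _∧_; _∨_; not)
  open import Data.Fin using (toℕ)
  open import Data.List using ([]; _++_)
  open import Data.List.Membership.Propositional using (_∈_)
  open import Data.List.Membership.Propositional.Properties using (∈-++⁻)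
  open import Data.List.Relation.Binary.Subset.Propositional using (_⊆_)
  open import Data.List.Relation.Binary.Subset.Propositional.Properties using (xs⊆xs++ys; xs⊆ys++xs)
  open import Data.Product using (_×_; _,_; proj₁; proj₂)
  open import Data.Sum using (_⊎_; inj₁; inj₂; swap)
  open import Data.Empty using (⊥; ⊥-elim)
  open import Relation.Binary.PropositionalEquality

  kcov≡ : ∀ {n} (S : Graph n) → kcov S ≡ tally (λ v → covered S v ∧ isRep S v) (allFin n)
  kcov≡ {n} S = count≡tally (λ v → covered S v ∧ isRep S v) (allFin n)

  k≡ : ∀ {n} (S : Graph n) → k S ≡ tally (isRep S) (allFin n)
  k≡ {n} S = count≡tally (isRep S) (allFin n)

  unc : ∀ {n} → Graph n → ℕ
  unc {n} S = tally (λ v → not (covered S v)) (allFin n)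

  module _ {n : ℕ} {S S' : Graph n} (s1 : S ⊆ S') (s2 : S' ⊆ S) where
    cov-≈ : ∀ v → covered S v ≡ covered S' v
    cov-≈ v = bool-ext (covered-subgraph s1 v) (covered-subgraph s2 v)

    rep-≈ : ∀ v → isRep S v ≡ isRep S' v
    rep-≈ v = cong not (any-cong (allFin n) λ u →
      cong ((toℕ u <ᵇ toℕ v) ∧_) (bool-ext (conn-sub s1) (conn-sub s2)))

    kcov-≈ : kcov S ≡ kcov S'
    kcov-≈ = trans (kcov≡ S) (trans (tally-cong (allFin n) (λ v → cong₂ _∧_ (cov-≈ v) (rep-≈ v))) (sym (kcov≡ S')))

    unc-≈ : unc S ≡ unc S'
    unc-≈ = tally-cong (allFin n) (λ v → cong not (cov-≈ v))

  vd-≈ : ∀ {n} {A A' B B' : Graph n} → A ⊆ A' → A' ⊆ A → B ⊆ B' → B' ⊆ B → vdisjoint A B ≡ vdisjoint A' B'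
  vd-≈ {n} a1 a2 b1 b2 = cong not (any-cong (allFin n) (λ v → cong₂ _∧_ (cov-≈ a1 a2 v) (cov-≈ b1 b2 v)))

  vd-elim : ∀ {n} (A B : Graph n) → vdisjoint A B ≡ true → ∀ z → covered A z ≡ true → covered B z ≡ false
  vd-elim {n} A B h z ca with bool-cases (covered B z)
  ... | inj₁ f = f
  ... | inj₂ t = ⊥-elim (true≢false
      (any-intro (λ v → covered A v ∧ covered B v) (allFin n) (allFin-∈ n z) (∧-intro ca t)) (not-true _ h))

  vd-intro : ∀ {n} (A B : Graph n) → (∀ z → covered A z ≡ true → covered B z ≡ false) → vdisjoint A B ≡ true
  vd-intro {n} A B h = not-intro _ (any-false _ (allFin n) λ {z} _ → not-both z)
    where not-both : ∀ z → (covered A z ∧ covered B z) ≡ false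
          not-both z with bool-cases (covered A z)
          ... | inj₁ f rewrite f = refl
          ... | inj₂ t rewrite t = h z t

  vd-false : ∀ {n} (A B : Graph n) → (vdisjoint A B ≡ true → ⊥) → vdisjoint A B ≡ false
  vd-false A B h with vdisjoint A B
  ... | true = ⊥-elim (h refl)
  ... | false = refl

  vd-shared-edge : ∀ {n} (A B : Graph n) {e} → e ∈ A → e ∈ B → vdisjoint A B ≡ false
  vd-shared-edge A B a b = vd-false A B (λ vd → true≢false (covered-src B b) (vd-elim A B vd _ (covered-src A a)))

  vd-sym : ∀ {n} (A B : Graph n) → vdisjoint A B ≡ true → vdisjoint B A ≡ true
  vd-sym A B h = vd-intro B A λ z cb → contrapose (covered A z) (vd-elim A B h z) cb
    where contrapose : ∀ a {b} → (a ≡ true → b ≡ false) → b ≡ true → a ≡ false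
          contrapose false f _ = refl
          contrapose true f bt = ⊥-elim (true≢false bt (f refl))

  vd-sub : ∀ {n} {X Y X' Y' : Graph n} → vdisjoint X Y ≡ true → X' ⊆ X → Y' ⊆ Y → vdisjoint X' Y' ≡ true
  vd-sub {n} {X} {Y} {X'} {Y'} h sx sy = vd-intro X' Y' λ z cx →
    contrapose (covered Y' z) (covered-subgraph sy z) (vd-elim X Y h z (covered-subgraph sx z cx))
    where contrapose : ∀ b {c} → (b ≡ true → c ≡ true) → c ≡ false → b ≡ false
          contrapose false f _ = refl
          contrapose true f c = ⊥-elim (true≢false (f refl) c)

  vd-[] : ∀ {n} (A : Graph n) → vdisjoint A [] ≡ true
  vd-[] A = vd-intro A [] λ z _ → refl

  cov-++ : ∀ {n} (X Y : Graph n) z → covered (X ++ Y) z ≡ covered X z ∨ covered Y z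
  cov-++ X Y z = any-++ (λ e → (proj₁ e == z) ∨ (proj₂ e == z)) X Y

  vd-++ : ∀ {n} (A1 B1 A2 B2 : Graph n) → vdisjoint A1 B2 ≡ true → vdisjoint A2 B1 ≡ true →
          vdisjoint (A1 ++ A2) (B1 ++ B2) ≡ (vdisjoint A1 B1 ∧ vdisjoint A2 B2)
  vd-++ A1 B1 A2 B2 h12 h21 = bool-ext to from
    where
    to : vdisjoint (A1 ++ A2) (B1 ++ B2) ≡ true → (vdisjoint A1 B1 ∧ vdisjoint A2 B2) ≡ true
    to h = ∧-intro (vd-sub h (xs⊆xs++ys A1 A2) (xs⊆xs++ys B1 B2)) (vd-sub h (xs⊆ys++xs A2 A1) (xs⊆ys++xs B2 B1))
    from : (vdisjoint A1 B1 ∧ vdisjoint A2 B2) ≡ true → vdisjoint (A1 ++ A2) (B1 ++ B2) ≡ true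
    from h = vd-intro (A1 ++ A2) (B1 ++ B2) λ z c → uncovered z (trans (sym (cov-++ A1 A2 z)) c)
      where
      h11 = proj₁ (∧-elim _ _ h)
      h22 = proj₂ (∧-elim _ _ h)
      uncovered : ∀ z → (covered A1 z ∨ covered A2 z) ≡ true → covered (B1 ++ B2) z ≡ false
      uncovered z c rewrite cov-++ B1 B2 z with ∨-elim (covered A1 z) _ c
      ... | inj₁ c1 rewrite vd-elim A1 B1 h11 z c1 | vd-elim A1 B2 h12 z c1 = refl
      ... | inj₂ c2 rewrite vd-elim A2 B1 h21 z c2 | vd-elim A2 B2 h22 z c2 = refl

  walk-stays-in : ∀ {n} (A B S : Graph n) → vdisjoint A B ≡ true →
    (∀ {f} → f ∈ S → covered A (proj₁ f) ≡ true ⊎ covered A (proj₂ f) ≡ true → f ∈ A ⊎ f ∈ B) →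
    ∀ j {v0 w} → covered A v0 ≡ true → Reaches j S v0 w → Reaches j A v0 w × covered A w ≡ true
  walk-stays-in A B S vd H zero {v0} {w} c h = h , subst (λ t → covered A t ≡ true) (reach-zero-inv S {v0} {w} h) c
  walk-stays-in A B S vd H (suc j) {v0} {w} c h with reach-suc-inv S j v0 w h
  ... | inj₁ q = let (a , b) = walk-stays-in A B S vd H j c q in reach-suc A j v0 w a , b
  ... | inj₂ (f , mf , inj₁ (q , refl)) with walk-stays-in A B S vd H j c q
  ... | (a , b) with H mf (inj₁ b)
  ... | inj₁ fA = reach-extend⃗ A j v0 f fA a , covered-tgt A fA
  ... | inj₂ fB = ⊥-elim (true≢false (covered-src B fB) (vd-elim A B vd _ b))
  walk-stays-in A B S vd H (suc j) {v0} {w} c h | inj₂ (f , mf , inj₂ (q , refl)) with walk-stays-in A B S vd H j c q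
  ... | (a , b) with H mf (inj₂ b)
  ... | inj₁ fA = reach-extend⃖ A j v0 f fA a , covered-src A fA
  ... | inj₂ fB = ⊥-elim (true≢false (covered-tgt B fB) (vd-elim A B vd _ b))

  rep-restrict : ∀ {n} (A B S : Graph n) → vdisjoint A B ≡ true → (∀ {f} → f ∈ S → f ∈ A ⊎ f ∈ B) → A ⊆ S →
                 ∀ v → covered A v ≡ true → isRep S v ≡ isRep A v
  rep-restrict {n} A B S vd sub aS v c =
    cong not (any-cong (allFin n) λ u → cong ((toℕ u <ᵇ toℕ v) ∧_) (same-connectivity u))
    where same-connectivity : ∀ u → connected S u v ≡ connected A u v
          same-connectivity u = bool-ext
            (λ h → conn-sym A (proj₁ (walk-stays-in A B S vd (λ m _ → sub m) n c (conn-sym S h))))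
            (conn-sub aS)

  kcov-++ : ∀ {n} (A B : Graph n) → vdisjoint A B ≡ true → kcov (A ++ B) ≡ kcov A + kcov B
  kcov-++ {n} A B vd = begin
      kcov (A ++ B)
    ≡⟨ kcov≡ (A ++ B) ⟩
      tally (λ v → covered (A ++ B) v ∧ isRep (A ++ B) v) (allFin n)
    ≡⟨ sumN-cong (allFin n) split-at ⟩
      sumN (λ v → ind (covered A v ∧ isRep A v) + ind (covered B v ∧ isRep B v)) (allFin n)
    ≡⟨ sumN-+ _ _ (allFin n) ⟩
      tally (λ v → covered A v ∧ isRep A v) (allFin n) + tally (λ v → covered B v ∧ isRep B v) (allFin n)
    ≡⟨ sym (cong₂ _+_ (kcov≡ A) (kcov≡ B)) ⟩
      kcov A + kcov B ∎
    where
    open ≡-Reasoning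
    split-at : ∀ v → ind (covered (A ++ B) v ∧ isRep (A ++ B) v)
                   ≡ ind (covered A v ∧ isRep A v) + ind (covered B v ∧ isRep B v)
    split-at v rewrite cov-++ A B v with bool-cases (covered A v)
    ... | inj₂ ca rewrite ca | vd-elim A B vd v ca
                        | rep-restrict A B (A ++ B) vd (∈-++⁻ A) (xs⊆xs++ys A B) v ca = sym (ℕP.+-identityʳ _)
    ... | inj₁ na rewrite na with bool-cases (covered B v)
    ...   | inj₁ nb rewrite nb = refl
    ...   | inj₂ cb rewrite cb | rep-restrict B A (A ++ B) (vd-sym A B vd) (λ m → swap (∈-++⁻ A m)) (xs⊆ys++xs B A) v cb = refl

  -- Every vertex is uncovered (a singleton component) or in a covered component.
  k-split : ∀ {n} (S : Graph n) → k S ≡ unc S + kcov S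
  k-split {n} S = begin
      k S
    ≡⟨ k≡ S ⟩
      tally (isRep S) (allFin n)
    ≡⟨ sumN-cong (allFin n) split-at ⟩
      sumN (λ v → ind (not (covered S v)) + ind (covered S v ∧ isRep S v)) (allFin n)
    ≡⟨ sumN-+ _ _ (allFin n) ⟩
      unc S + tally (λ v → covered S v ∧ isRep S v) (allFin n)
    ≡⟨ cong (unc S +_) (sym (kcov≡ S)) ⟩
      unc S + kcov S ∎
    where
    open ≡-Reasoning
    split-at : ∀ v → ind (isRep S v) ≡ ind (not (covered S v)) + ind (covered S v ∧ isRep S v)
    split-at v with bool-cases (covered S v)
    ... | inj₁ f rewrite f | Rep.uncovered⇒isRep S v f = refl
    ... | inj₂ t rewrite t = refl

  kcov-[] : ∀ {n} → kcov {n} [] ≡ 0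
  kcov-[] {n} = trans (kcov≡ {n} []) (sumN-0 (allFin n))

module IntegerSums where

  open import Defs using (sumℤ)
  open Tallies using (sumN)
  open import Data.Nat using (ℕ)
  open import Data.Bool using (Bool; true; false; if_then_else_)
  import Data.Bool as B
  open import Data.Integer using (ℤ; +_; _+_; _*_)
  import Data.Integer.Properties as ℤP
  open import Algebra.Properties.CommutativeSemigroup ℤP.+-commutativeSemigroup using (interchange)
  open import Data.List using (List; []; _∷_; map; _++_; concatMap; filter)
  open import Data.List.Membership.Propositional using (_∈_)
  open import Data.List.Relation.Unary.Any using (here; there)
  open import Relation.Binary.PropositionalEquality

  Σℤ : ∀ {A : Set} → (A → ℤ) → List A → ℤ
  Σℤ f [] = + 0
  Σℤ f (x ∷ xs) = f x + Σℤ f xs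

  module _ {A : Set} where
    Σℤ-cong : ∀ {f g : A → ℤ} xs → (∀ x → f x ≡ g x) → Σℤ f xs ≡ Σℤ g xs
    Σℤ-cong [] h = refl
    Σℤ-cong (x ∷ xs) h = cong₂ _+_ (h x) (Σℤ-cong xs h)

    Σℤ-cong∈ : ∀ {f g : A → ℤ} xs → (∀ {x} → x ∈ xs → f x ≡ g x) → Σℤ f xs ≡ Σℤ g xs
    Σℤ-cong∈ [] h = refl
    Σℤ-cong∈ (x ∷ xs) h = cong₂ _+_ (h (here refl)) (Σℤ-cong∈ xs (λ m → h (there m)))

    Σℤ-0 : ∀ xs → Σℤ (λ (_ : A) → + 0) xs ≡ + 0
    Σℤ-0 [] = refl
    Σℤ-0 (x ∷ xs) = trans (ℤP.+-identityˡ _) (Σℤ-0 xs)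

    Σℤ-++ : ∀ (f : A → ℤ) xs ys → Σℤ f (xs ++ ys) ≡ Σℤ f xs + Σℤ f ys
    Σℤ-++ f [] ys = sym (ℤP.+-identityˡ _)
    Σℤ-++ f (x ∷ xs) ys rewrite Σℤ-++ f xs ys = sym (ℤP.+-assoc (f x) _ _)

    Σℤ-+ : ∀ (f g : A → ℤ) xs → Σℤ (λ x → f x + g x) xs ≡ Σℤ f xs + Σℤ g xs
    Σℤ-+ f g [] = refl
    Σℤ-+ f g (x ∷ xs) rewrite Σℤ-+ f g xs = interchange (f x) (g x) (Σℤ f xs) (Σℤ g xs)

    Σℤ-*l : ∀ c (f : A → ℤ) xs → Σℤ (λ x → c * f x) xs ≡ c * Σℤ f xs
    Σℤ-*l c f [] = sym (ℤP.*-zeroʳ c)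
    Σℤ-*l c f (x ∷ xs) rewrite Σℤ-*l c f xs = sym (ℤP.*-distribˡ-+ c (f x) _)

    Σℤ-*r : ∀ c (f : A → ℤ) xs → Σℤ (λ x → f x * c) xs ≡ Σℤ f xs * c
    Σℤ-*r c f [] = sym (ℤP.*-zeroˡ c)
    Σℤ-*r c f (x ∷ xs) rewrite Σℤ-*r c f xs = sym (ℤP.*-distribʳ-+ c (f x) _)

    Σℤ-pos : ∀ (f : A → ℕ) xs → + sumN f xs ≡ Σℤ (λ x → + f x) xs
    Σℤ-pos f [] = refl
    Σℤ-pos f (x ∷ xs) = trans (ℤP.pos-+ (f x) (sumN f xs)) (cong (λ t → + f x + t) (Σℤ-pos f xs))

  Σℤ-map : ∀ {A B : Set} (f : B → ℤ) (g : A → B) xs → Σℤ f (map g xs) ≡ Σℤ (λ x → f (g x)) xs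
  Σℤ-map f g [] = refl
  Σℤ-map f g (x ∷ xs) = cong (λ t → f (g x) + t) (Σℤ-map f g xs)

  Σℤ-swap : ∀ {A B : Set} (f : A → B → ℤ) xs ys →
            Σℤ (λ x → Σℤ (λ y → f x y) ys) xs ≡ Σℤ (λ y → Σℤ (λ x → f x y) xs) ys
  Σℤ-swap f [] ys = sym (Σℤ-0 ys)
  Σℤ-swap f (x ∷ xs) ys rewrite Σℤ-swap f xs ys = sym (Σℤ-+ (f x) (λ y → Σℤ (λ x → f x y) xs) ys)

  sumℤ-++ : ∀ xs ys → sumℤ (xs ++ ys) ≡ sumℤ xs + sumℤ ys
  sumℤ-++ [] ys = sym (ℤP.+-identityˡ _)
  sumℤ-++ (x ∷ xs) ys rewrite sumℤ-++ xs ys = sym (ℤP.+-assoc x _ _)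

  sumℤ-concatMap : ∀ {A : Set} (h : A → List ℤ) xs → sumℤ (concatMap h xs) ≡ Σℤ (λ a → sumℤ (h a)) xs
  sumℤ-concatMap h [] = refl
  sumℤ-concatMap h (x ∷ xs) =
    trans (sumℤ-++ (h x) (concatMap h xs)) (cong (λ t → sumℤ (h x) + t) (sumℤ-concatMap h xs))

  sumℤ-map-filter : ∀ {A : Set} (p : A → Bool) (k : A → ℤ) ys →
    sumℤ (map k (filter (λ b → p b B.≟ true) ys)) ≡ Σℤ (λ b → if p b then k b else + 0) ys
  sumℤ-map-filter p k [] = refl
  sumℤ-map-filter p k (y ∷ ys) with p y
  ... | true = cong (λ t → k y + t) (sumℤ-map-filter p k ys)
  ... | false = sym (trans (ℤP.+-identityˡ _) (sym (sumℤ-map-filter p k ys)))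

-- Sums over splits are the bridge between sums over
-- pairs of edge subsets (as in ξ) and sums over single edge subsets.
module Splits where

  open import Defs using (subsets)
  open IntegerSums
  open import Data.Nat using (suc; _+_)
  import Data.Nat.Properties as ℕP
  open import Data.Bool using (Bool; true; false; not; if_then_else_)
  open import Data.Integer using (ℤ; +_) renaming (_+_ to _+ℤ_)
  import Data.Integer.Properties as ℤP
  open import Data.List using (List; []; _∷_; map; length; _++_; filterᵇ; null)
  open import Data.List.Membership.Propositional using (_∈_)
  open import Data.List.Membership.Propositional.Properties using (∈-map⁻; ∈-++⁻; ∈-++⁺ˡ; ∈-++⁺ʳ)
  open import Data.List.Relation.Binary.Subset.Propositional using (_⊆_)
  open import Data.List.Relation.Binary.Subset.Propositional.Properties using (⊆-refl; ∷⁺ʳ)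
  open import Data.List.Relation.Unary.Any using (here; there)
  open import Data.Product using (_×_; _,_; proj₁; proj₂)
  open import Data.Sum using (_⊎_; inj₁; inj₂; map₁; map₂; swap)
  open import Relation.Binary.PropositionalEquality

  splits : ∀ {T : Set} → List T → List (List T × List T)
  splits [] = ([] , []) ∷ []
  splits (e ∷ S) = map (λ q → (e ∷ proj₁ q , proj₂ q)) (splits S) ++ map (λ q → (proj₁ q , e ∷ proj₂ q)) (splits S)

  record IsSplit {T : Set} (X A B : List T) : Set where
    field
      A⊆X : A ⊆ X
      B⊆X : B ⊆ X
      X⊆A∪B : ∀ {e} → e ∈ X → e ∈ A ⊎ e ∈ B
      lengths : length A + length B ≡ length X

  splits-sound : ∀ {T : Set} (X : List T) {q} → q ∈ splits X → IsSplit X (proj₁ q) (proj₂ q)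
  splits-sound [] (here refl) = record { A⊆X = λ () ; B⊆X = λ () ; X⊆A∪B = λ () ; lengths = refl }
  splits-sound (e ∷ X) {q} m with ∈-++⁻ (map (λ q → (e ∷ proj₁ q , proj₂ q)) (splits X)) m
  ... | inj₁ mA with ∈-map⁻ (λ q → (e ∷ proj₁ q , proj₂ q)) mA
  ... | (q' , m' , refl) = let open IsSplit (splits-sound X m') in record
    { A⊆X = ∷⁺ʳ e A⊆X
    ; B⊆X = λ z → there (B⊆X z)
    ; X⊆A∪B = λ { (here refl) → inj₁ (here refl) ; (there z) → map₁ there (X⊆A∪B z) }
    ; lengths = cong suc lengths }
  splits-sound (e ∷ X) {q} m | inj₂ mB with ∈-map⁻ (λ q → (proj₁ q , e ∷ proj₂ q)) mB
  ... | (q' , m' , refl) = let open IsSplit (splits-sound X m') in record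
    { A⊆X = λ z → there (A⊆X z)
    ; B⊆X = ∷⁺ʳ e B⊆X
    ; X⊆A∪B = λ { (here refl) → inj₂ (here refl) ; (there z) → map₂ there (X⊆A∪B z) }
    ; lengths = trans (ℕP.+-suc _ _) (cong suc lengths) }

  IsSplit-swap : ∀ {T : Set} {X A B : List T} → IsSplit X A B → IsSplit X B A
  IsSplit-swap {A = A} {B} s = record
    { A⊆X = B⊆X ; B⊆X = A⊆X ; X⊆A∪B = λ m → swap (X⊆A∪B m) ; lengths = trans (ℕP.+-comm (length B) (length A)) lengths }
    where open IsSplit s

  Σsplits : ∀ {T : Set} → (List T → List T → ℤ) → List T → ℤ
  Σsplits F X = Σℤ (λ q → F (proj₁ q) (proj₂ q)) (splits X)

  Σsplits-cons : ∀ {T : Set} (F : List T → List T → ℤ) e X →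
                 Σsplits F (e ∷ X) ≡ Σsplits (λ A B → F (e ∷ A) B) X +ℤ Σsplits (λ A B → F A (e ∷ B)) X
  Σsplits-cons F e X = trans (Σℤ-++ f (map toA (splits X)) (map toB (splits X)))
                             (cong₂ _+ℤ_ (Σℤ-map f toA (splits X)) (Σℤ-map f toB (splits X)))
    where f = λ (q : List _ × List _) → F (proj₁ q) (proj₂ q)
          toA = λ (q : List _ × List _) → (e ∷ proj₁ q , proj₂ q)
          toB = λ (q : List _ × List _) → (proj₁ q , e ∷ proj₂ q)

  Σsplits-emptyB : ∀ {T : Set} (c : ℤ) (X : List T) → Σsplits (λ A B → if null B then c else + 0) X ≡ c
  Σsplits-emptyB c [] = ℤP.+-identityʳ c
  Σsplits-emptyB c (e ∷ X) = begin
      Σsplits (λ A B → if null B then c else + 0) (e ∷ X)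
    ≡⟨ Σsplits-cons (λ A B → if null B then c else + 0) e X ⟩
      Σsplits (λ A B → if null B then c else + 0) X +ℤ Σℤ (λ _ → + 0) (splits X)
    ≡⟨ cong₂ _+ℤ_ (Σsplits-emptyB c X) (Σℤ-0 (splits X)) ⟩
      c +ℤ + 0
    ≡⟨ ℤP.+-identityʳ c ⟩
      c ∎
    where open ≡-Reasoning

  Σsplits-emptyA : ∀ {T : Set} (c : ℤ) (X : List T) → Σsplits (λ A B → if null A then c else + 0) X ≡ c
  Σsplits-emptyA c [] = ℤP.+-identityʳ c
  Σsplits-emptyA c (e ∷ X) = begin
      Σsplits (λ A B → if null A then c else + 0) (e ∷ X)
    ≡⟨ Σsplits-cons (λ A B → if null A then c else + 0) e X ⟩
      Σℤ (λ _ → + 0) (splits X) +ℤ Σsplits (λ A B → if null A then c else + 0) X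
    ≡⟨ cong₂ _+ℤ_ (Σℤ-0 (splits X)) (Σsplits-emptyA c X) ⟩
      + 0 +ℤ c
    ≡⟨ ℤP.+-identityˡ c ⟩
      c ∎
    where open ≡-Reasoning

  RespectsSetEq : ∀ {T : Set} → (List T → List T → ℤ) → Set
  RespectsSetEq {T} F = ∀ {A A' B B' : List T} → A ⊆ A' → A' ⊆ A → B ⊆ B' → B' ⊆ B → F A B ≡ F A' B'

  respects-consˡ : ∀ {T : Set} {F : List T → List T → ℤ} e → RespectsSetEq F → RespectsSetEq (λ A B → F (e ∷ A) B)
  respects-consˡ e r a1 a2 b1 b2 = r (∷⁺ʳ e a1) (∷⁺ʳ e a2) b1 b2

  respects-consʳ : ∀ {T : Set} {F : List T → List T → ℤ} e → RespectsSetEq F → RespectsSetEq (λ A B → F A (e ∷ B))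
  respects-consʳ e r a1 a2 b1 b2 = r a1 a2 (∷⁺ʳ e b1) (∷⁺ʳ e b2)

  move-middle : ∀ {T : Set} (X : List T) {e Y} → (X ++ e ∷ Y) ⊆ (e ∷ (X ++ Y))
  move-middle X {e} {Y} m with ∈-++⁻ X m
  ... | inj₁ a = there (∈-++⁺ˡ a)
  ... | inj₂ (here refl) = here refl
  ... | inj₂ (there b) = there (∈-++⁺ʳ X b)

  move-middle⁻ : ∀ {T : Set} (X : List T) {e Y} → (e ∷ (X ++ Y)) ⊆ (X ++ e ∷ Y)
  move-middle⁻ X (here refl) = ∈-++⁺ʳ X (here refl)
  move-middle⁻ X (there m) with ∈-++⁻ X m
  ... | inj₁ a = ∈-++⁺ˡ a
  ... | inj₂ b = ∈-++⁺ʳ X (there b)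

  Σsplits-partition : ∀ {T : Set} (p : T → Bool) (F : List T → List T → ℤ) → RespectsSetEq F → ∀ S →
    Σsplits F S ≡ Σsplits (λ A1 B1 → Σsplits (λ A2 B2 → F (A1 ++ A2) (B1 ++ B2)) (filterᵇ (λ x → not (p x)) S)) (filterᵇ p S)
  Σsplits-partition p F r [] = sym (ℤP.+-identityʳ _)
  Σsplits-partition p F r (e ∷ S) with p e
  ... | true = begin
      Σsplits F (e ∷ S)
    ≡⟨ Σsplits-cons F e S ⟩
      Σsplits Fˡ S +ℤ Σsplits Fʳ S
    ≡⟨ cong₂ _+ℤ_ (Σsplits-partition p Fˡ (respects-consˡ e r) S) (Σsplits-partition p Fʳ (respects-consʳ e r) S) ⟩
      Σsplits (λ A1 B1 → G (e ∷ A1) B1) yes +ℤ Σsplits (λ A1 B1 → G A1 (e ∷ B1)) yes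
    ≡⟨ sym (Σsplits-cons G e yes) ⟩
      Σsplits G (e ∷ yes) ∎
    where
    open ≡-Reasoning
    Fˡ = λ A B → F (e ∷ A) B
    Fʳ = λ A B → F A (e ∷ B)
    yes = filterᵇ p S
    G = λ A1 B1 → Σsplits (λ A2 B2 → F (A1 ++ A2) (B1 ++ B2)) (filterᵇ (λ x → not (p x)) S)
  ... | false = begin
      Σsplits F (e ∷ S)
    ≡⟨ Σsplits-cons F e S ⟩
      Σsplits Fˡ S +ℤ Σsplits Fʳ S
    ≡⟨ cong₂ _+ℤ_ (Σsplits-partition p Fˡ (respects-consˡ e r) S) (Σsplits-partition p Fʳ (respects-consʳ e r) S) ⟩
      Σℤ Gˡ (splits yes) +ℤ Σℤ Gʳ (splits yes)
    ≡⟨ sym (Σℤ-+ Gˡ Gʳ (splits yes)) ⟩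
      Σℤ (λ q1 → Gˡ q1 +ℤ Gʳ q1) (splits yes)
    ≡⟨ Σℤ-cong (splits yes) e-to-second ⟩
      Σℤ G (splits yes) ∎
    where
    open ≡-Reasoning
    Fˡ = λ A B → F (e ∷ A) B
    Fʳ = λ A B → F A (e ∷ B)
    yes = filterᵇ p S
    no = filterᵇ (λ x → not (p x)) S
    G = λ (q1 : List _ × List _) → Σsplits (λ A2 B2 → F (proj₁ q1 ++ A2) (proj₂ q1 ++ B2)) (e ∷ no)
    Gˡ = λ (q1 : List _ × List _) → Σsplits (λ A2 B2 → Fˡ (proj₁ q1 ++ A2) (proj₂ q1 ++ B2)) no
    Gʳ = λ (q1 : List _ × List _) → Σsplits (λ A2 B2 → Fʳ (proj₁ q1 ++ A2) (proj₂ q1 ++ B2)) no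
    e-to-second : ∀ q1 → Gˡ q1 +ℤ Gʳ q1 ≡ G q1
    e-to-second (A1 , B1) = sym (trans (Σsplits-cons (λ A B → F (A1 ++ A) (B1 ++ B)) e no)
      (cong₂ _+ℤ_ (Σℤ-cong (splits no) (λ q2 → r (move-middle A1) (move-middle⁻ A1) ⊆-refl ⊆-refl))
                  (Σℤ-cong (splits no) (λ q2 → r ⊆-refl ⊆-refl (move-middle B1) (move-middle⁻ B1)))))

  -- Pairs (A , B) of sub-multisets of E with no common entry are the splits
  -- of sub-multisets S of E; pairs with a common entry contribute nothing.
  Σpairs≡Σsplits : ∀ {T : Set} (H : List T → List T → ℤ) → (∀ {A B e} → e ∈ A → e ∈ B → H A B ≡ + 0) → ∀ E →
    Σℤ (λ A → Σℤ (λ B → H A B) (subsets E)) (subsets E) ≡ Σℤ (Σsplits H) (subsets E)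
  Σpairs≡Σsplits H shared-vanishes [] = refl
  Σpairs≡Σsplits H shared-vanishes (e ∷ E) = begin
      Σℤ (λ A → Σℤ (H A) (r ++ m)) (r ++ m)
    ≡⟨ Σℤ-cong (r ++ m) split-B ⟩
      Σℤ (λ A → Σℤ (H A) r +ℤ Σℤ (λ B → H A (e ∷ B)) r) (r ++ m)
    ≡⟨ Σℤ-++ _ r m ⟩
      Σℤ (λ A → Σℤ (H A) r +ℤ Σℤ (λ B → H A (e ∷ B)) r) r +ℤ Σℤ (λ A → Σℤ (H A) r +ℤ Σℤ (λ B → H A (e ∷ B)) r) m
    ≡⟨ cong₂ _+ℤ_ (Σℤ-+ _ _ r) (trans (Σℤ-map _ (e ∷_) r) (Σℤ-+ _ _ r)) ⟩
      (Σℤ (λ A → Σℤ (H A) r) r +ℤ Σℤ (λ A → Σℤ (λ B → H A (e ∷ B)) r) r) +ℤ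
      (Σℤ (λ A → Σℤ (H (e ∷ A)) r) r +ℤ Σℤ (λ A → Σℤ (λ B → H (e ∷ A) (e ∷ B)) r) r)
    ≡⟨ cong₂ _+ℤ_ (cong₂ _+ℤ_ (Σpairs≡Σsplits H shared-vanishes E) (Σpairs≡Σsplits Hʳ (λ a b → shared-vanishes a (there b)) E))
                  (cong₂ _+ℤ_ (Σpairs≡Σsplits Hˡ (λ a b → shared-vanishes (there a) b) E) both-get-e) ⟩
      (Σℤ (Σsplits H) r +ℤ Σℤ (Σsplits Hʳ) r) +ℤ (Σℤ (Σsplits Hˡ) r +ℤ + 0)
    ≡⟨ cong (λ t → (Σℤ (Σsplits H) r +ℤ Σℤ (Σsplits Hʳ) r) +ℤ t) (ℤP.+-identityʳ _) ⟩
      (Σℤ (Σsplits H) r +ℤ Σℤ (Σsplits Hʳ) r) +ℤ Σℤ (Σsplits Hˡ) r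
    ≡⟨ trans (ℤP.+-assoc (Σℤ (Σsplits H) r) (Σℤ (Σsplits Hʳ) r) (Σℤ (Σsplits Hˡ) r))
             (cong (Σℤ (Σsplits H) r +ℤ_) (ℤP.+-comm (Σℤ (Σsplits Hʳ) r) (Σℤ (Σsplits Hˡ) r))) ⟩
      Σℤ (Σsplits H) r +ℤ (Σℤ (Σsplits Hˡ) r +ℤ Σℤ (Σsplits Hʳ) r)
    ≡⟨ cong (Σℤ (Σsplits H) r +ℤ_) (sym (Σℤ-+ (Σsplits Hˡ) (Σsplits Hʳ) r)) ⟩
      Σℤ (Σsplits H) r +ℤ Σℤ (λ S → Σsplits Hˡ S +ℤ Σsplits Hʳ S) r
    ≡⟨ cong (Σℤ (Σsplits H) r +ℤ_) (trans (Σℤ-cong r (λ S → sym (Σsplits-cons H e S))) (sym (Σℤ-map (Σsplits H) (e ∷_) r))) ⟩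
      Σℤ (Σsplits H) r +ℤ Σℤ (Σsplits H) m
    ≡⟨ sym (Σℤ-++ (Σsplits H) r m) ⟩
      Σℤ (Σsplits H) (r ++ m) ∎
    where
    open ≡-Reasoning
    r = subsets E
    m = map (e ∷_) r
    Hˡ = λ A B → H (e ∷ A) B
    Hʳ = λ A B → H A (e ∷ B)
    split-B : ∀ A → Σℤ (H A) (r ++ m) ≡ Σℤ (H A) r +ℤ Σℤ (λ B → H A (e ∷ B)) r
    split-B A = trans (Σℤ-++ (H A) r m) (cong (Σℤ (H A) r +ℤ_) (Σℤ-map (H A) (e ∷_) r))
    both-get-e : Σℤ (λ A → Σℤ (λ B → H (e ∷ A) (e ∷ B)) r) r ≡ + 0
    both-get-e = trans (Σℤ-cong r (λ A → trans (Σℤ-cong r (λ B → shared-vanishes (here refl) (here refl))) (Σℤ-0 r))) (Σℤ-0 r)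

-- Peel off the
-- component K of the first edge: splits of S are pairs of splits of K and of
-- the rest, weights multiply, and K (being connected) splits vertex-disjointly
-- only as (K , ∅) or (∅ , K), contributing a + b.
module ComponentPolynomial where

  open import Defs
  open Booleans
  open Tallies
  open Walks
  open Connectivity
  open Representatives
  open ComponentCounts
  open IntegerSums
  open Splits
  open import Data.Nat as ℕ using (ℕ; suc; _≤_; s≤s)
  import Data.Nat.Properties as ℕP
  open import Data.Integer using (ℤ; +_; _+_; _*_; _^_)
  import Data.Integer.Properties as ℤP
  open import Algebra.Properties.CommutativeSemigroup ℤP.*-commutativeSemigroup using (interchange)
  open import Data.Bool using (Bool; true; false; _∧_; not; if_then_else_)
  open import Data.Fin using (Fin)
  open import Data.List using ([]; _∷_; length; _++_; filterᵇ; null)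
  open import Data.List.Properties using (length-filter)
  open import Data.List.Membership.Propositional using (_∈_)
  open import Data.List.Membership.Propositional.Properties using (∈-++⁻; ∈-++⁺ˡ; ∈-++⁺ʳ)
  open import Data.List.Relation.Binary.Subset.Propositional using (_⊆_)
  open import Data.List.Relation.Binary.Subset.Propositional.Properties using (∷⁺ʳ)
  open import Data.List.Relation.Unary.Any using (here; there)
  open import Data.Product using (_×_; _,_; proj₁; proj₂)
  open import Data.Sum using (_⊎_; inj₁; inj₂; [_,_]′)
  open import Data.Empty using (⊥; ⊥-elim)
  open import Function using (_∘_)
  open import Relation.Nullary.Decidable using (T?)
  open import Relation.Binary.PropositionalEquality

  module Peel {n : ℕ} (e : Fin n × Fin n) (S' : Graph n) where
    S : Graph n
    S = e ∷ S'

    inComp : Fin n × Fin n → Bool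
    inComp f = connected S (proj₁ e) (proj₁ f)

    K Rest K' : Graph n
    K = filterᵇ inComp S
    Rest = filterᵇ (not ∘ inComp) S
    K' = filterᵇ inComp S'

    e-inComp : inComp e ≡ true
    e-inComp = conn-refl S (proj₁ e)

    K≡ : K ≡ e ∷ K'
    K≡ rewrite e-inComp = refl

    Rest≡ : Rest ≡ filterᵇ (not ∘ inComp) S'
    Rest≡ rewrite e-inComp = refl

    Rest-shorter : length Rest ≤ length S'
    Rest-shorter rewrite Rest≡ = length-filter (T? ∘ (not ∘ inComp)) S'

    K⊆S : K ⊆ S
    K⊆S m = proj₁ (filterᵇ-∈ inComp S m)

    Rest⊆S : Rest ⊆ S
    Rest⊆S m = proj₁ (filterᵇ-∈ (not ∘ inComp) S m)

    ∈K-src : ∀ {f} → f ∈ S → Conn S (proj₁ e) (proj₁ f) → f ∈ K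
    ∈K-src m c = filterᵇ-intro inComp S m c

    ∈K-tgt : ∀ {f} → f ∈ S → Conn S (proj₁ e) (proj₂ f) → f ∈ K
    ∈K-tgt m c = ∈K-src m (conn-trans S c (conn-sym S (conn-edge S m)))

    covered-K⇒conn : ∀ z → covered K z ≡ true → Conn S (proj₁ e) z
    covered-K⇒conn z h with covered-inv K z h
    ... | g , m , inj₁ refl = proj₂ (filterᵇ-∈ inComp S m)
    ... | g , m , inj₂ refl = conn-trans S (proj₂ (filterᵇ-∈ inComp S m)) (conn-edge S (K⊆S m))

    K-or-Rest : ∀ {f} → f ∈ S → f ∈ K ⊎ f ∈ Rest
    K-or-Rest {f} m with bool-cases (inComp f)
    ... | inj₂ t = inj₁ (filterᵇ-intro inComp S m t)
    ... | inj₁ fl = inj₂ (filterᵇ-intro (not ∘ inComp) S m (not-intro _ fl))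

    vd-K-Rest : vdisjoint K Rest ≡ true
    vd-K-Rest = vd-intro K Rest λ z ck → not-in-Rest z (covered-K⇒conn z ck)
      where
      not-in-Rest : ∀ z → Conn S (proj₁ e) z → covered Rest z ≡ false
      not-in-Rest z c with bool-cases (covered Rest z)
      ... | inj₁ f = f
      ... | inj₂ t with covered-inv Rest z t
      ... | g , m , touches-z = ⊥-elim (true≢false (proj₂ (filterᵇ-∈ inComp S (g∈K touches-z))) (not-true (inComp g) g-outside))
        where
        g-outside = proj₂ (filterᵇ-∈ (not ∘ inComp) S m)
        g∈K : proj₁ g ≡ z ⊎ proj₂ g ≡ z → g ∈ K
        g∈K (inj₁ refl) = ∈K-src (Rest⊆S m) c
        g∈K (inj₂ refl) = ∈K-tgt (Rest⊆S m) c

    kcov-K : kcov K ≡ 1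
    kcov-K = trans (kcov≡ K) (trans (tally-cong (allFin n) is-ρ) (tally-single n ρ))
      where
      ρ = Rep.repOf S (proj₁ e)
      rep-K≡rep-S : ∀ v → covered K v ≡ true → isRep S v ≡ isRep K v
      rep-K≡rep-S v c = rep-restrict K Rest S vd-K-Rest K-or-Rest K⊆S v c
      covered-K-ρ : covered K ρ ≡ true
      covered-K-ρ with covered-inv S ρ (Rep.repOf-covered S (proj₁ e) (covered-src S (here refl)))
      ... | g , m , inj₁ refl = covered-src K (∈K-src m (conn-sym S (Rep.repOf-conn S (proj₁ e))))
      ... | g , m , inj₂ refl = covered-tgt K (∈K-tgt m (conn-sym S (Rep.repOf-conn S (proj₁ e))))
      is-ρ : ∀ v → (covered K v ∧ isRep K v) ≡ (v == ρ)
      is-ρ v = bool-ext to from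
        where
        to : (covered K v ∧ isRep K v) ≡ true → (v == ρ) ≡ true
        to h = let (c , rp) = ∧-elim (covered K v) _ h in
          ==-intro (trans (sym (Rep.isRep⇒repOf S v (trans (rep-K≡rep-S v c) rp)))
                          (sym (Rep.repOf-cong S (covered-K⇒conn v c))))
        from : (v == ρ) ≡ true → (covered K v ∧ isRep K v) ≡ true
        from h with ==-sound {u = v} {v = ρ} h
        ... | refl = ∧-intro covered-K-ρ (trans (sym (rep-K≡rep-S ρ covered-K-ρ)) (Rep.isRep-repOf S (proj₁ e)))

    kcov-peel : kcov S ≡ suc (kcov Rest)
    kcov-peel = trans (kcov-≈ S⊆K++Rest K++Rest⊆S) (trans (kcov-++ K Rest vd-K-Rest) (cong (ℕ._+ kcov Rest) kcov-K))
      where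
      K++Rest⊆S : (K ++ Rest) ⊆ S
      K++Rest⊆S m = [ K⊆S , Rest⊆S ]′ (∈-++⁻ K m)
      S⊆K++Rest : S ⊆ (K ++ Rest)
      S⊆K++Rest m = [ ∈-++⁺ˡ , ∈-++⁺ʳ K ]′ (K-or-Rest m)

    -- A vertex-disjoint cover (A , B) of K with e ∈ A has B empty: walks from
    -- e inside K stay in A.
    K-connected : ∀ (A B : Graph n) → A ⊆ K → (∀ {f} → f ∈ K → f ∈ A ⊎ f ∈ B) → e ∈ A →
                  vdisjoint A B ≡ true → ∀ {f} → f ∈ B → f ∈ K → ⊥
    K-connected A B A⊆K K⊆A∪B eA vd {f} fB fK =
      true≢false (covered-src B fB) (vd-elim A B vd (proj₁ f) (proj₂ stays))
      where
      touching-A : ∀ {g} → g ∈ S → covered A (proj₁ g) ≡ true ⊎ covered A (proj₂ g) ≡ true → g ∈ A ⊎ g ∈ B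
      touching-A m (inj₁ c) = K⊆A∪B (∈K-src m (covered-K⇒conn _ (covered-subgraph A⊆K _ c)))
      touching-A m (inj₂ c) = K⊆A∪B (∈K-tgt m (covered-K⇒conn _ (covered-subgraph A⊆K _ c)))
      stays = walk-stays-in A B S vd touching-A n (covered-src A eA) (proj₂ (filterᵇ-∈ inComp S fK))

    toK : ∀ {X : Graph n} → X ⊆ (e ∷ K') → X ⊆ K
    toK s m = subst (_ ∈_) (sym K≡) (s m)

    split-K-overlaps : ∀ {A B} → IsSplit K' A B → ∀ {f} → f ∈ B → vdisjoint (e ∷ A) B ≡ false
    split-K-overlaps {A} {B} s fB = vd-false (e ∷ A) B (λ vd →
      K-connected (e ∷ A) B (toK (∷⁺ʳ e A⊆X)) cover (here refl) vd fB (toK (there ∘ B⊆X) fB))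
      where
      open IsSplit s
      cover : ∀ {g} → g ∈ K → g ∈ e ∷ A ⊎ g ∈ B
      cover m with subst (_ ∈_) K≡ m
      ... | here refl = inj₁ (here refl)
      ... | there z = [ inj₁ ∘ there , inj₂ ]′ (X⊆A∪B z)

    kcov-whole-K : ∀ {A} → IsSplit K' A [] → kcov (e ∷ A) ≡ 1
    kcov-whole-K {A} s = trans (kcov-≈ (∷⁺ʳ e A⊆X) (∷⁺ʳ e K'⊆A)) (trans (cong kcov (sym K≡)) kcov-K)
      where
      open IsSplit s
      K'⊆A : K' ⊆ A
      K'⊆A z with X⊆A∪B z
      ... | inj₁ y = y
      ... | inj₂ ()

  kcov≤length-bounded : ∀ {n} m (S : Graph n) → length S ≤ m → kcov S ≤ length S
  kcov≤length-bounded {n} m [] _ = ℕP.≤-reflexive (kcov-[] {n})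
  kcov≤length-bounded (suc m) (e ∷ S') (s≤s le) =
    let open Peel e S' in
    subst (_≤ length (e ∷ S')) (sym kcov-peel)
      (s≤s (ℕP.≤-trans (kcov≤length-bounded m Rest (ℕP.≤-trans Rest-shorter le)) Rest-shorter))

  kcov≤length : ∀ {n} (S : Graph n) → kcov S ≤ length S
  kcov≤length S = kcov≤length-bounded (length S) S ℕP.≤-refl

  module Weight {n : ℕ} (a b : ℤ) where
    weight : Graph n → Graph n → ℤ
    weight A B = if vdisjoint A B then a ^ kcov A * b ^ kcov B else + 0

    weight-disjoint : ∀ {X Y : Graph n} → vdisjoint X Y ≡ true → weight X Y ≡ a ^ kcov X * b ^ kcov Y
    weight-disjoint h rewrite h = refl

    weight-not-disjoint : ∀ {X Y : Graph n} → vdisjoint X Y ≡ false → weight X Y ≡ + 0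
    weight-not-disjoint h rewrite h = refl

    weight-respects : RespectsSetEq weight
    weight-respects a1 a2 b1 b2 rewrite vd-≈ a1 a2 b1 b2 | kcov-≈ a1 a2 | kcov-≈ b1 b2 = refl

    weight-++ : ∀ (A1 B1 A2 B2 : Graph n) → vdisjoint A1 B2 ≡ true → vdisjoint A2 B1 ≡ true →
      vdisjoint A1 A2 ≡ true → vdisjoint B1 B2 ≡ true → weight (A1 ++ A2) (B1 ++ B2) ≡ weight A1 B1 * weight A2 B2
    weight-++ A1 B1 A2 B2 h12 h21 hA hB rewrite vd-++ A1 B1 A2 B2 h12 h21
      with vdisjoint A1 B1 | vdisjoint A2 B2
    ... | false | _ = sym (ℤP.*-zeroˡ (if vdisjoint A2 B2 then a ^ kcov A2 * b ^ kcov B2 else + 0))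
    ... | true | false = sym (ℤP.*-zeroʳ (a ^ kcov A1 * b ^ kcov B1))
    ... | true | true rewrite kcov-++ A1 A2 hA | kcov-++ B1 B2 hB
          | ℤP.^-distribˡ-+-* a (kcov A1) (kcov A2) | ℤP.^-distribˡ-+-* b (kcov B1) (kcov B2) =
          interchange (a ^ kcov A1) (a ^ kcov A2) (b ^ kcov B1) (b ^ kcov B2)

    module _ (e : Fin n × Fin n) (S' : Graph n) where
      open Peel e S'

      Σsplits-weight-factor : Σsplits weight S ≡ Σsplits weight K * Σsplits weight Rest
      Σsplits-weight-factor = begin
          Σsplits weight S
        ≡⟨ Σsplits-partition inComp weight weight-respects S ⟩
          Σℤ (λ q1 → Σℤ (λ q2 → weight (proj₁ q1 ++ proj₁ q2) (proj₂ q1 ++ proj₂ q2)) (splits Rest)) (splits K)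
        ≡⟨ Σℤ-cong∈ (splits K) (λ m1 → Σℤ-cong∈ (splits Rest) (λ m2 → factor m1 m2)) ⟩
          Σℤ (λ q1 → Σℤ (λ q2 → weight (proj₁ q1) (proj₂ q1) * weight (proj₁ q2) (proj₂ q2)) (splits Rest)) (splits K)
        ≡⟨ Σℤ-cong (splits K) (λ q1 → Σℤ-*l (weight (proj₁ q1) (proj₂ q1)) (λ q2 → weight (proj₁ q2) (proj₂ q2)) (splits Rest)) ⟩
          Σℤ (λ q1 → weight (proj₁ q1) (proj₂ q1) * Σsplits weight Rest) (splits K)
        ≡⟨ Σℤ-*r (Σsplits weight Rest) (λ q1 → weight (proj₁ q1) (proj₂ q1)) (splits K) ⟩
          Σsplits weight K * Σsplits weight Rest ∎
        where
        open ≡-Reasoning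
        factor : ∀ {q1 q2} → q1 ∈ splits K → q2 ∈ splits Rest →
                 weight (proj₁ q1 ++ proj₁ q2) (proj₂ q1 ++ proj₂ q2) ≡ weight (proj₁ q1) (proj₂ q1) * weight (proj₁ q2) (proj₂ q2)
        factor {A1 , B1} {A2 , B2} m1 m2 =
          weight-++ A1 B1 A2 B2 (vd-sub vd-K-Rest s1.A⊆X s2.B⊆X) (vd-sub (vd-sym K Rest vd-K-Rest) s2.A⊆X s1.B⊆X)
                    (vd-sub vd-K-Rest s1.A⊆X s2.A⊆X) (vd-sub vd-K-Rest s1.B⊆X s2.B⊆X)
          where module s1 = IsSplit (splits-sound K m1)
                module s2 = IsSplit (splits-sound Rest m2)

      -- The component K contributes a (all of K in A) plus b (all of K in B).
      Σsplits-weight-K : Σsplits weight K ≡ a + b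
      Σsplits-weight-K = begin
          Σsplits weight K
        ≡⟨ cong (Σsplits weight) K≡ ⟩
          Σsplits weight (e ∷ K')
        ≡⟨ Σsplits-cons weight e K' ⟩
          Σsplits (λ A B → weight (e ∷ A) B) K' + Σsplits (λ A B → weight A (e ∷ B)) K'
        ≡⟨ cong₂ _+_ (trans (Σℤ-cong∈ (splits K') e-in-A) (Σsplits-emptyB a K'))
                     (trans (Σℤ-cong∈ (splits K') e-in-B) (Σsplits-emptyA b K')) ⟩
          a + b ∎
        where
        open ≡-Reasoning
        e-in-A : ∀ {q} → q ∈ splits K' → weight (e ∷ proj₁ q) (proj₂ q) ≡ (if null (proj₂ q) then a else + 0)
        e-in-A {A , []} mq = begin
            weight (e ∷ A) []
          ≡⟨ weight-disjoint {e ∷ A} {[]} (vd-[] (e ∷ A)) ⟩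
            a ^ kcov (e ∷ A) * b ^ kcov {n} []
          ≡⟨ cong₂ (λ u v → a ^ u * b ^ v) (kcov-whole-K (splits-sound K' mq)) (kcov-[] {n}) ⟩
            a * + 1 * + 1
          ≡⟨ trans (ℤP.*-identityʳ _) (ℤP.*-identityʳ a) ⟩
            a ∎
        e-in-A {A , f ∷ B} mq = weight-not-disjoint (split-K-overlaps (splits-sound K' mq) (here refl))
        e-in-B : ∀ {q} → q ∈ splits K' → weight (proj₁ q) (e ∷ proj₂ q) ≡ (if null (proj₁ q) then b else + 0)
        e-in-B {[] , B} mq = begin
            weight [] (e ∷ B)
          ≡⟨ weight-disjoint {[]} {e ∷ B} (vd-intro [] (e ∷ B) (λ z ())) ⟩
            a ^ kcov {n} [] * b ^ kcov (e ∷ B)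
          ≡⟨ cong₂ (λ u v → a ^ u * b ^ v) (kcov-[] {n}) (kcov-whole-K (IsSplit-swap (splits-sound K' mq))) ⟩
            + 1 * (b * + 1)
          ≡⟨ trans (ℤP.*-identityˡ _) (ℤP.*-identityʳ b) ⟩
            b ∎
        e-in-B {f ∷ A , B} mq = weight-not-disjoint (vd-false (f ∷ A) (e ∷ B) (λ vd →
          true≢false (vd-sym (f ∷ A) (e ∷ B) vd) (split-K-overlaps (IsSplit-swap (splits-sound K' mq)) (here refl))))

    Σsplits-weight-bounded : ∀ m (S : Graph n) → length S ≤ m → Σsplits weight S ≡ (a + b) ^ kcov S
    Σsplits-weight-bounded m [] _ rewrite vd-[] {n} [] | kcov-[] {n} = refl
    Σsplits-weight-bounded (suc m) (e ∷ S') (s≤s le) = begin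
        Σsplits weight (e ∷ S')
      ≡⟨ Σsplits-weight-factor e S' ⟩
        Σsplits weight K * Σsplits weight Rest
      ≡⟨ cong₂ _*_ (Σsplits-weight-K e S') (Σsplits-weight-bounded m Rest (ℕP.≤-trans Rest-shorter le)) ⟩
        (a + b) * (a + b) ^ kcov Rest
      ≡⟨ cong ((a + b) ^_) (sym kcov-peel) ⟩
        (a + b) ^ kcov (e ∷ S') ∎
      where
      open ≡-Reasoning
      open Peel e S'

    Σsplits-weight : ∀ (S : Graph n) → Σsplits weight S ≡ (a + b) ^ kcov S
    Σsplits-weight S = Σsplits-weight-bounded (length S) S ℕP.≤-refl

module Enumeration where

  open import Defs
  open Booleans
  open Tallies
  open import Data.Nat using (ℕ; zero; suc; _≤_; s≤s; _*_; _^_)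
  import Data.Nat.Properties as ℕP
  open import Algebra.Properties.CommutativeSemigroup ℕP.*-commutativeSemigroup using (x∙yz≈y∙xz)
  open import Data.Bool using (Bool; true; false; _∧_; not; if_then_else_)
  open import Data.Fin as F using (Fin)
  import Data.Fin.Properties as FP
  open import Data.Vec using (Vec; []; _∷_)
  import Data.Vec.Properties as VP
  open import Data.List using (List; []; _∷_; map; length; concatMap)
  open import Data.Bool.ListAction using (all)
  open import Data.Product using (_,_)
  open import Relation.Nullary using (yes; no)
  open import Relation.Nullary.Decidable using (does)
  open import Data.Empty using (⊥-elim)
  open import Relation.Binary.PropositionalEquality

  all-map : ∀ {A B : Set} (p : B → Bool) (g : A → B) xs → all p (map g xs) ≡ all (λ x → p (g x)) xs
  all-map p g [] = refl
  all-map p g (x ∷ xs) = cong (p (g x) ∧_) (all-map p g xs)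

  count-product : ∀ n x (p : Fin n → Fin x → Bool) →
    tally (λ φ → all (λ v → p v (lookup φ v)) (allFin n)) (allMaps n x) ≡ prodN (λ v → tally (p v) (allFin x)) (allFin n)
  count-product zero x p = refl
  count-product (suc n) x p = begin
      tally Q (concatMap (λ c → map (c ∷_) (allMaps n x)) (allFin x))
    ≡⟨ sumN-concatMap (λ φ → ind (Q φ)) (λ c → map (c ∷_) (allMaps n x)) (allFin x) ⟩
      sumN (λ c → tally Q (map (c ∷_) (allMaps n x))) (allFin x)
    ≡⟨ sumN-cong (allFin x) (λ c → sumN-map (λ φ → ind (Q φ)) (c ∷_) (allMaps n x)) ⟩
      sumN (λ c → tally (λ φ → Q (c ∷ φ)) (allMaps n x)) (allFin x)
    ≡⟨ sumN-cong (allFin x) (λ c → trans (tally-cong (allMaps n x) (λ φ → cong (p F.zero c ∧_) (all-map _ F.suc (allFin n))))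
                                          (tally-∧ (p F.zero c) Q' (allMaps n x))) ⟩
      sumN (λ c → ind (p F.zero c) * tally Q' (allMaps n x)) (allFin x)
    ≡⟨ sumN-*r (tally Q' (allMaps n x)) (λ c → ind (p F.zero c)) (allFin x) ⟩
      tally (p F.zero) (allFin x) * tally Q' (allMaps n x)
    ≡⟨ cong (tally (p F.zero) (allFin x) *_) (trans (count-product n x (λ v → p (F.suc v))) (sym (prodN-map _ F.suc (allFin n)))) ⟩
      prodN (λ v → tally (p v) (allFin x)) (allFin (suc n)) ∎
    where
    open ≡-Reasoning
    Q : Vec (Fin x) (suc n) → Bool
    Q φ = all (λ v → p v (lookup φ v)) (allFin (suc n))
    Q' : Vec (Fin x) n → Bool
    Q' φ = all (λ v → p (F.suc v) (lookup φ v)) (allFin n)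

  eqV : ∀ {n x} → Vec (Fin x) n → Vec (Fin x) n → Bool
  eqV a b = does (VP.≡-dec FP._≟_ a b)

  eqV-sound : ∀ {n x} (a b : Vec (Fin x) n) → eqV a b ≡ true → a ≡ b
  eqV-sound a b h with VP.≡-dec FP._≟_ a b
  ... | yes e = e

  eqV-intro : ∀ {n x} {a b : Vec (Fin x) n} → a ≡ b → eqV a b ≡ true
  eqV-intro {a = a} refl with VP.≡-dec FP._≟_ a a
  ... | yes _ = refl
  ... | no ne = ⊥-elim (ne refl)

  eqV-cons : ∀ {n x} (c c0 : Fin x) (φ a : Vec (Fin x) n) → eqV (c ∷ φ) (c0 ∷ a) ≡ ((c == c0) ∧ eqV φ a)
  eqV-cons c c0 φ a = bool-ext to from
    where
    to : eqV (c ∷ φ) (c0 ∷ a) ≡ true → ((c == c0) ∧ eqV φ a) ≡ true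
    to h with eqV-sound (c ∷ φ) (c0 ∷ a) h
    ... | refl = ∧-intro (==-refl c) (eqV-intro {a = φ} refl)
    from : ((c == c0) ∧ eqV φ a) ≡ true → eqV (c ∷ φ) (c0 ∷ a) ≡ true
    from h = let (h1 , h2) = ∧-elim (c == c0) _ h in
      eqV-intro (cong₂ _∷_ (==-sound {u = c} {v = c0} h1) (eqV-sound φ a h2))

  allMaps-unique : ∀ n x (a : Vec (Fin x) n) → tally (λ b → eqV b a) (allMaps n x) ≡ 1
  allMaps-unique zero x [] = refl
  allMaps-unique (suc n) x (a0 ∷ a) = begin
      tally (λ b → eqV b (a0 ∷ a)) (concatMap (λ c → map (c ∷_) (allMaps n x)) (allFin x))
    ≡⟨ sumN-concatMap _ (λ c → map (c ∷_) (allMaps n x)) (allFin x) ⟩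
      sumN (λ c → tally (λ b → eqV b (a0 ∷ a)) (map (c ∷_) (allMaps n x))) (allFin x)
    ≡⟨ sumN-cong (allFin x) (λ c → trans (sumN-map (λ b → ind (eqV b (a0 ∷ a))) (c ∷_) (allMaps n x))
          (trans (tally-cong (allMaps n x) (λ φ → eqV-cons c a0 φ a)) (tally-∧ (c == a0) (λ φ → eqV φ a) (allMaps n x)))) ⟩
      sumN (λ c → ind (c == a0) * tally (λ φ → eqV φ a) (allMaps n x)) (allFin x)
    ≡⟨ sumN-*r _ (λ c → ind (c == a0)) (allFin x) ⟩
      tally (λ c → c == a0) (allFin x) * tally (λ φ → eqV φ a) (allMaps n x)
    ≡⟨ cong₂ _*_ (tally-single x a0) (allMaps-unique n x a) ⟩
      1 ∎
    where open ≡-Reasoning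

  -- In a list where every element occurs once, maps f and g that are mutually
  -- inverse between the elements passing P and those passing Q show that P
  -- and Q have equal tallies (double counting the pairs (a , b) with b = f a).
  count-bijection : ∀ {A : Set} (eq : A → A → Bool) (Ls : List A) → (∀ a → tally (λ b → eq b a) Ls ≡ 1) →
    (P Q : A → Bool) (f g : A → A) → (∀ a b → (P a ∧ eq b (f a)) ≡ (Q b ∧ eq a (g b))) → tally P Ls ≡ tally Q Ls
  count-bijection eq Ls once P Q f g inverse = begin
      tally P Ls
    ≡⟨ sumN-cong Ls (λ a → sym (trans (cong (ind (P a) *_) (once (f a))) (ℕP.*-identityʳ (ind (P a))))) ⟩
      sumN (λ a → ind (P a) * tally (λ b → eq b (f a)) Ls) Ls
    ≡⟨ sumN-cong Ls (λ a → sym (tally-∧ (P a) (λ b → eq b (f a)) Ls)) ⟩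
      sumN (λ a → tally (λ b → P a ∧ eq b (f a)) Ls) Ls
    ≡⟨ sumN-cong Ls (λ a → tally-cong Ls (λ b → inverse a b)) ⟩
      sumN (λ a → tally (λ b → Q b ∧ eq a (g b)) Ls) Ls
    ≡⟨ sumN-swap (λ a b → ind (Q b ∧ eq a (g b))) Ls Ls ⟩
      sumN (λ b → tally (λ a → Q b ∧ eq a (g b)) Ls) Ls
    ≡⟨ sumN-cong Ls (λ b → tally-∧ (Q b) (λ a → eq a (g b)) Ls) ⟩
      sumN (λ b → ind (Q b) * tally (λ a → eq a (g b)) Ls) Ls
    ≡⟨ sumN-cong Ls (λ b → trans (cong (ind (Q b) *_) (once (g b))) (ℕP.*-identityʳ (ind (Q b)))) ⟩
      tally Q Ls ∎
    where open ≡-Reasoning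

  tally-proper : ∀ x y → y ≤ x → tally (λ (c : Fin x) → proper y c) (allFin x) ≡ y
  tally-proper zero zero _ = refl
  tally-proper (suc x) zero _ = trans (sumN-map (λ c → ind (proper 0 c)) F.suc (allFin x)) (sumN-0 (allFin x))
  tally-proper (suc x) (suc y) (s≤s le) =
    cong suc (trans (sumN-map (λ c → ind (proper (suc y) c)) F.suc (allFin x)) (tally-proper x y le))

  tally-all : ∀ x → tally (λ (c : Fin x) → true) (allFin x) ≡ x
  tally-all x = trans (tally-true (allFin x)) (allFin-length x)
    where tally-true : ∀ (xs : List (Fin x)) → tally (λ _ → true) xs ≡ length xs
          tally-true [] = refl
          tally-true (_ ∷ xs) = cong suc (tally-true xs)

  product-powers : ∀ {A : Set} (c d : A → Bool) (x y : ℕ) xs →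
    prodN (λ v → if c v then (if d v then y else 1) else x) xs ≡ x ^ tally (λ v → not (c v)) xs * y ^ tally (λ v → c v ∧ d v) xs
  product-powers c d x y [] = refl
  product-powers c d x y (v ∷ xs) with c v | d v
  ... | true | true rewrite product-powers c d x y xs =
    x∙yz≈y∙xz y (x ^ tally (λ v → not (c v)) xs) (y ^ tally (λ v → c v ∧ d v) xs)
  ... | true | false rewrite product-powers c d x y xs = ℕP.+-identityʳ _
  ... | false | _ rewrite product-powers c d x y xs = sym (ℕP.*-assoc x _ _)

-- A colouring violates an edge when it breaks the edge's condition: the
-- colourings violating every edge of S are those constant on each component
-- of (V,S) with a proper colour on every component meeting S.  Collapsing
-- each component to its least vertex puts them in bijection with the
-- "canonical" colourings: any colour on uncovered vertices, a proper colour on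
-- the other representatives, colour 0 on non-representatives.
module ViolatingColourings where

  open import Defs
  open Booleans
  open Tallies
  open Walks
  open Connectivity
  open Representatives
  open ComponentCounts
  open Enumeration
  open import Data.Nat using (ℕ; suc; _≤_; _^_; _*_)
  open import Data.Bool using (Bool; true; false; _∧_; not; if_then_else_)
  open import Data.Fin as F using (Fin)
  open import Data.Vec using (Vec; tabulate)
  import Data.Vec.Properties as VP
  open import Data.List.Membership.Propositional using (_∈_)
  open import Data.Bool.ListAction using (all)
  open import Data.Product using (_×_; _,_; proj₁; proj₂)
  open import Data.Sum using (inj₁; inj₂)
  open import Relation.Binary.PropositionalEquality

  violated : ∀ {n x} → ℕ → Vec (Fin x) n → Fin n × Fin n → Bool
  violated y φ e = not (edgeOK y φ e)

  violated-elim : ∀ {n x} y (φ : Vec (Fin x) n) u v → violated y φ (u , v) ≡ true →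
                  lookup φ u ≡ lookup φ v × proper y (lookup φ u) ≡ true
  violated-elim y φ u v h with u == v in eq
  ... | true = cong (lookup φ) (==-sound {u = u} {v = v} eq) , not-not _ h
    where not-not : ∀ b → not (not b) ≡ true → b ≡ true
          not-not true _ = refl
  ... | false with lookup φ u == lookup φ v in same | proper y (lookup φ u) | proper y (lookup φ v)
  ...   | true | true | true = ==-sound {u = lookup φ u} {v = lookup φ v} same , refl

  violated-intro : ∀ {n x} y (φ : Vec (Fin x) n) u v → lookup φ u ≡ lookup φ v → proper y (lookup φ u) ≡ true →
                   violated y φ (u , v) ≡ true
  violated-intro y φ u v same pu with u == v
  ... | true rewrite pu = refl
  ... | false rewrite pu | sym same | ==-refl (lookup φ u) | pu = refl

  lookup-tabulate : ∀ {n x} (h : Fin n → Fin x) v → lookup (tabulate h) v ≡ h v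
  lookup-tabulate h v = VP.lookup∘tabulate h v

  vec-ext : ∀ {n x} {a b : Vec (Fin x) n} → (∀ v → lookup a v ≡ lookup b v) → a ≡ b
  vec-ext {a = a} {b} h = trans (sym (VP.tabulate∘lookup a)) (trans (VP.tabulate-cong h) (VP.tabulate∘lookup b))

  module ViolatingCount {n : ℕ} (x' y : ℕ) (S : Graph n) (y≤x : y ≤ suc x') where
    x = suc x'
    open Rep S

    allViolated : Vec (Fin x) n → Bool
    allViolated φ = all (violated y φ) S

    canonicalColour : Fin n → Fin x → Bool
    canonicalColour v c = if isRep S v then (if covered S v then proper y c else true) else (c == F.zero)

    isCanonical : Vec (Fin x) n → Bool
    isCanonical ψ = all (λ v → canonicalColour v (lookup ψ v)) (allFin n)

    compress : Vec (Fin x) n → Vec (Fin x) n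
    compress φ = tabulate (λ v → if isRep S v then lookup φ v else F.zero)

    expand : Vec (Fin x) n → Vec (Fin x) n
    expand ψ = tabulate (λ v → lookup ψ (repOf v))

    module _ (φ : Vec (Fin x) n) (violates : allViolated φ ≡ true) where
      violates-edge : ∀ {e} → e ∈ S → lookup φ (proj₁ e) ≡ lookup φ (proj₂ e) × proper y (lookup φ (proj₁ e)) ≡ true
      violates-edge {u , v} m = violated-elim y φ u v (all-elim (violated y φ) S violates m)

      constant-on-components : ∀ {u v} → Conn S u v → lookup φ u ≡ lookup φ v
      constant-on-components = conn-const S (lookup φ) (λ m → proj₁ (violates-edge m))

      compress-canonical : isCanonical (compress φ) ≡ true
      compress-canonical = all-intro _ (allFin n) (λ {v} _ → allowed v)
        where
        allowed : ∀ v → canonicalColour v (lookup (compress φ) v) ≡ true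
        allowed v rewrite lookup-tabulate (λ v → if isRep S v then lookup φ v else F.zero) v with isRep S v
        ... | false = ==-refl (F.zero {x'})
        ... | true with bool-cases (covered S v)
        ...   | inj₁ nc rewrite nc = refl
        ...   | inj₂ c rewrite c with covered-inv S v c
        ...     | e , m , inj₁ refl = proj₂ (violates-edge m)
        ...     | e , m , inj₂ refl = subst (λ t → proper y t ≡ true) (proj₁ (violates-edge m)) (proj₂ (violates-edge m))

      expand-compress : φ ≡ expand (compress φ)
      expand-compress = vec-ext λ v → begin
          lookup φ v
        ≡⟨ sym (constant-on-components (repOf-conn v)) ⟩
          lookup φ (repOf v)
        ≡⟨ sym (cong (λ b → if b then lookup φ (repOf v) else F.zero) (isRep-repOf v)) ⟩
          (if isRep S (repOf v) then lookup φ (repOf v) else F.zero)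
        ≡⟨ sym (lookup-tabulate (λ v → if isRep S v then lookup φ v else F.zero) (repOf v)) ⟩
          lookup (compress φ) (repOf v)
        ≡⟨ sym (lookup-tabulate (λ v → lookup (compress φ) (repOf v)) v) ⟩
          lookup (expand (compress φ)) v ∎
        where open ≡-Reasoning

    module _ (ψ : Vec (Fin x) n) (canonical : isCanonical ψ ≡ true) where
      allowed : ∀ v → canonicalColour v (lookup ψ v) ≡ true
      allowed v = all-elim (λ v → canonicalColour v (lookup ψ v)) (allFin n) canonical (allFin-∈ n v)

      lookup-expand : ∀ v → lookup (expand ψ) v ≡ lookup ψ (repOf v)
      lookup-expand v = lookup-tabulate (λ v → lookup ψ (repOf v)) v

      expand-violates : allViolated (expand ψ) ≡ true
      expand-violates = all-intro _ S λ {e} m → violates e m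
        where
        proper-rep : ∀ v → covered S v ≡ true → proper y (lookup ψ (repOf v)) ≡ true
        proper-rep v c with allowed (repOf v)
        ... | q rewrite isRep-repOf v | repOf-covered v c = q
        violates : ∀ e → e ∈ S → violated y (expand ψ) e ≡ true
        violates (u , v) m = violated-intro y (expand ψ) u v
          (trans (lookup-expand u) (trans (cong (lookup ψ) (repOf-cong (conn-edge S m))) (sym (lookup-expand v))))
          (subst (λ t → proper y t ≡ true) (sym (lookup-expand u)) (proper-rep u (covered-src S m)))

      compress-expand : ψ ≡ compress (expand ψ)
      compress-expand = vec-ext same-at
        where
        same-at : ∀ v → lookup ψ v ≡ lookup (compress (expand ψ)) v
        same-at v rewrite lookup-tabulate (λ v → if isRep S v then lookup (expand ψ) v else F.zero) v with isRep S v in rep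
        ... | true = sym (trans (lookup-expand v) (cong (lookup ψ) (isRep⇒repOf v rep)))
        ... | false with allowed v
        ...   | q rewrite rep = ==-sound {u = lookup ψ v} {v = F.zero} q

    compress-expand-inverse : ∀ φ ψ → (allViolated φ ∧ eqV ψ (compress φ)) ≡ (isCanonical ψ ∧ eqV φ (expand ψ))
    compress-expand-inverse φ ψ = bool-ext to from
      where
      to : (allViolated φ ∧ eqV ψ (compress φ)) ≡ true → (isCanonical ψ ∧ eqV φ (expand ψ)) ≡ true
      to h with ∧-elim (allViolated φ) _ h
      ... | (v , e) with eqV-sound ψ (compress φ) e
      ... | refl = ∧-intro (compress-canonical φ v) (eqV-intro (expand-compress φ v))
      from : (isCanonical ψ ∧ eqV φ (expand ψ)) ≡ true → (allViolated φ ∧ eqV ψ (compress φ)) ≡ true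
      from h with ∧-elim (isCanonical ψ) _ h
      ... | (c , e) with eqV-sound φ (expand ψ) e
      ... | refl = ∧-intro (expand-violates ψ c) (eqV-intro (compress-expand ψ c))

    count-canonicalColour : ∀ v → tally (canonicalColour v) (allFin x)
                                ≡ (if covered S v then (if isRep S v then y else 1) else x)
    count-canonicalColour v with covered S v in cv | isRep S v in rp
    ... | true | true = tally-proper x y y≤x
    ... | true | false = tally-single x F.zero
    ... | false | true = tally-all x
    ... | false | false with () ← trans (sym (uncovered⇒isRep v cv)) rp

    count-allViolated : tally allViolated (allMaps n x) ≡ x ^ unc S * y ^ kcov S
    count-allViolated = begin
        tally allViolated (allMaps n x)
      ≡⟨ count-bijection eqV (allMaps n x) (allMaps-unique n x) allViolated isCanonical compress expand compress-expand-inverse ⟩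
        tally isCanonical (allMaps n x)
      ≡⟨ count-product n x canonicalColour ⟩
        prodN (λ v → tally (canonicalColour v) (allFin x)) (allFin n)
      ≡⟨ prodN-cong (allFin n) count-canonicalColour ⟩
        prodN (λ v → if covered S v then (if isRep S v then y else 1) else x) (allFin n)
      ≡⟨ product-powers (covered S) (isRep S) x y (allFin n) ⟩
        x ^ unc S * y ^ tally (λ v → covered S v ∧ isRep S v) (allFin n)
      ≡⟨ cong (λ t → x ^ unc S * y ^ t) (sym (kcov≡ S)) ⟩
        x ^ unc S * y ^ kcov S ∎
      where open ≡-Reasoning

module Expansion where

  open import Defs
  open Tallies
  open ComponentCounts
  open IntegerSums
  open Splits
  open ComponentPolynomial
  open ViolatingColourings
  open import Data.Nat as ℕ using (ℕ; zero; suc; _≤_; _∸_)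
  import Data.Nat.Properties as ℕP
  open import Data.Integer using (ℤ; +_; _+_; _*_; _^_; -_; _-_)
  import Data.Integer.Properties as ℤP
  open import Algebra.Properties.CommutativeSemigroup ℤP.*-commutativeSemigroup using (interchange)
  open import Data.Integer.Solver using (module +-*-Solver)
  open import Data.Bool using (true; false; _∧_; not; if_then_else_)
  open import Data.Fin using (Fin)
  open import Data.Vec using (Vec)
  open import Data.List using (List; []; _∷_; map; length; _++_)
  open import Data.List.Membership.Propositional using (_∈_)
  open import Data.List.Membership.Propositional.Properties using (∈-++⁺ˡ; ∈-++⁺ʳ; ∈-++⁻)
  open import Data.List.Relation.Binary.Subset.Propositional using (_⊆_)
  open import Data.Bool.ListAction using (all)
  open import Data.Product using (_,_; proj₁; proj₂)
  open import Data.Sum using ([_,_]′)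
  open import Relation.Binary.PropositionalEquality

  pos-^ : ∀ m k → + (m ℕ.^ k) ≡ (+ m) ^ k
  pos-^ m zero = refl
  pos-^ m (suc k) = trans (ℤP.pos-* m (m ℕ.^ k)) (cong (+ m *_) (pos-^ m k))

  ^-distribʳ-* : ∀ a b k → (a * b) ^ k ≡ a ^ k * b ^ k
  ^-distribʳ-* a b zero = refl
  ^-distribʳ-* a b (suc k) rewrite ^-distribʳ-* a b k = interchange a b (a ^ k) (b ^ k)

  minus1 : ℤ
  minus1 = - (+ 1)

  minus1² : ∀ k → minus1 ^ k * minus1 ^ k ≡ + 1
  minus1² k = trans (sym (^-distribʳ-* minus1 minus1 k)) (ℤP.^-zeroˡ k)

  sign : ∀ {T : Set} → List T → ℤ
  sign S = minus1 ^ length S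

  sign-shift : ∀ m c (z : ℤ) → c ≤ m → minus1 ^ (m ∸ c) * z ^ c ≡ minus1 ^ m * (- z) ^ c
  sign-shift m c z c≤m = begin
      minus1 ^ (m ∸ c) * z ^ c
    ≡⟨ cong (_* z ^ c) (sym (ℤP.*-identityʳ (minus1 ^ (m ∸ c)))) ⟩
      minus1 ^ (m ∸ c) * + 1 * z ^ c
    ≡⟨ cong (λ t → minus1 ^ (m ∸ c) * t * z ^ c) (sym (minus1² c)) ⟩
      minus1 ^ (m ∸ c) * (minus1 ^ c * minus1 ^ c) * z ^ c
    ≡⟨ solve 3 (λ s u w → s :* (u :* u) :* w := s :* u :* (u :* w)) refl (minus1 ^ (m ∸ c)) (minus1 ^ c) (z ^ c) ⟩
      minus1 ^ (m ∸ c) * minus1 ^ c * (minus1 ^ c * z ^ c)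
    ≡⟨ cong₂ _*_ (sym (trans (cong (minus1 ^_) (sym (ℕP.m∸n+n≡m c≤m))) (ℤP.^-distribˡ-+-* minus1 (m ∸ c) c)))
                 (trans (sym (^-distribʳ-* minus1 z c)) (cong (_^ c) (ℤP.-1*i≡-i z))) ⟩
      minus1 ^ m * (- z) ^ c ∎
    where open ≡-Reasoning
          open +-*-Solver

  satisfied-or-violated : ∀ b t → + ind b * t ≡ t + (- + ind (not b)) * t
  satisfied-or-violated true t = trans (ℤP.*-identityˡ t) (sym (trans (cong (λ u → t + u) (ℤP.*-zeroˡ t)) (ℤP.+-identityʳ t)))
  satisfied-or-violated false t = trans (ℤP.*-zeroˡ t) (sym (trans (cong (λ u → t + u) (ℤP.-1*i≡-i t)) (ℤP.+-inverseʳ t)))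

  inclusion-exclusion : ∀ {n x} y (φ : Vec (Fin x) n) (E : Graph n) →
    + ind (all (edgeOK y φ) E) ≡ Σℤ (λ S → sign S * + ind (all (violated y φ) S)) (subsets E)
  inclusion-exclusion y φ [] = refl
  inclusion-exclusion y φ (e ∷ E) = begin
      + ind (edgeOK y φ e ∧ all (edgeOK y φ) E)
    ≡⟨ trans (cong +_ (ind-∧ (edgeOK y φ e) _)) (ℤP.pos-* (ind (edgeOK y φ e)) _) ⟩
      + ind (edgeOK y φ e) * + ind (all (edgeOK y φ) E)
    ≡⟨ cong (+ ind (edgeOK y φ e) *_) (inclusion-exclusion y φ E) ⟩
      + ind (edgeOK y φ e) * Σℤ f r
    ≡⟨ satisfied-or-violated (edgeOK y φ e) (Σℤ f r) ⟩
      Σℤ f r + (- + ind (violated y φ e)) * Σℤ f r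
    ≡⟨ cong (λ u → Σℤ f r + u) (sym (Σℤ-*l (- + ind (violated y φ e)) f r)) ⟩
      Σℤ f r + Σℤ (λ S → (- + ind (violated y φ e)) * f S) r
    ≡⟨ cong (λ u → Σℤ f r + u) (sym (trans (Σℤ-map f (e ∷_) r) (Σℤ-cong r add-e))) ⟩
      Σℤ f r + Σℤ f (map (e ∷_) r)
    ≡⟨ sym (Σℤ-++ f r (map (e ∷_) r)) ⟩
      Σℤ f (r ++ map (e ∷_) r) ∎
    where
    open ≡-Reasoning
    r = subsets E
    f = λ S → sign S * + ind (all (violated y φ) S)
    add-e : ∀ S → f (e ∷ S) ≡ (- + ind (violated y φ e)) * f S
    add-e S = begin
        minus1 * minus1 ^ length S * + ind (violated y φ e ∧ all (violated y φ) S)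
      ≡⟨ cong (minus1 * minus1 ^ length S *_) (trans (cong +_ (ind-∧ (violated y φ e) _)) (ℤP.pos-* (ind (violated y φ e)) _)) ⟩
        minus1 * minus1 ^ length S * (+ ind (violated y φ e) * + ind (all (violated y φ) S))
      ≡⟨ solve 3 (λ s a b → con minus1 :* s :* (a :* b) := (:- a) :* (s :* b)) refl
           (minus1 ^ length S) (+ ind (violated y φ e)) (+ ind (all (violated y φ) S)) ⟩
        (- + ind (violated y φ e)) * f S ∎
      where open +-*-Solver

  P-expansion : ∀ {n} (E : Graph n) x' y → y ≤ suc x' →
    + P E (suc x') y ≡ Σℤ (λ S → sign S * (+ suc x') ^ unc S * (+ y) ^ kcov S) (subsets E)
  P-expansion {n} E x' y y≤x = begin
      + P E x y
    ≡⟨ cong +_ (count≡tally (isGenColoring y E) (allMaps n x)) ⟩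
      + tally (λ φ → all (edgeOK y φ) E) (allMaps n x)
    ≡⟨ Σℤ-pos _ (allMaps n x) ⟩
      Σℤ (λ φ → + ind (all (edgeOK y φ) E)) (allMaps n x)
    ≡⟨ Σℤ-cong (allMaps n x) (λ φ → inclusion-exclusion y φ E) ⟩
      Σℤ (λ φ → Σℤ (λ S → sign S * + ind (all (violated y φ) S)) (subsets E)) (allMaps n x)
    ≡⟨ Σℤ-swap (λ φ S → sign S * + ind (all (violated y φ) S)) (allMaps n x) (subsets E) ⟩
      Σℤ (λ S → Σℤ (λ φ → sign S * + ind (all (violated y φ) S)) (allMaps n x)) (subsets E)
    ≡⟨ Σℤ-cong (subsets E) count-for ⟩
      Σℤ (λ S → sign S * (+ x) ^ unc S * (+ y) ^ kcov S) (subsets E) ∎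
    where
    open ≡-Reasoning
    x = suc x'
    count-for : ∀ S → Σℤ (λ φ → sign S * + ind (all (violated y φ) S)) (allMaps n x) ≡ sign S * (+ x) ^ unc S * (+ y) ^ kcov S
    count-for S = begin
        Σℤ (λ φ → sign S * + ind (all (violated y φ) S)) (allMaps n x)
      ≡⟨ Σℤ-*l (sign S) (λ φ → + ind (all (violated y φ) S)) (allMaps n x) ⟩
        sign S * Σℤ (λ φ → + ind (all (violated y φ) S)) (allMaps n x)
      ≡⟨ cong (sign S *_) (sym (Σℤ-pos (λ φ → ind (all (violated y φ) S)) (allMaps n x))) ⟩
        sign S * + tally (λ φ → all (violated y φ) S) (allMaps n x)
      ≡⟨ cong (λ t → sign S * + t) (ViolatingCount.count-allViolated x' y S y≤x) ⟩
        sign S * + (x ℕ.^ unc S ℕ.* y ℕ.^ kcov S)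
      ≡⟨ cong (sign S *_) (trans (ℤP.pos-* (x ℕ.^ unc S) (y ℕ.^ kcov S)) (cong₂ _*_ (pos-^ x (unc S)) (pos-^ y (kcov S)))) ⟩
        sign S * ((+ x) ^ unc S * (+ y) ^ kcov S)
      ≡⟨ sym (ℤP.*-assoc (sign S) _ _) ⟩
        sign S * (+ x) ^ unc S * (+ y) ^ kcov S ∎

  module XiExpansion {n : ℕ} (x y : ℕ) where
    X Z : ℤ
    X = + x
    Z = + x - + y

    ξsummand : Graph n → Graph n → ℤ
    ξsummand A B = if vdisjoint A B then ξterm X minus1 Z A B else + 0

    ξ-as-pairs : ∀ (E : Graph n) → ξ E X minus1 Z ≡ Σℤ (λ A → Σℤ (λ B → ξsummand A B) (subsets E)) (subsets E)
    ξ-as-pairs E = trans (sumℤ-concatMap _ (subsets E))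
      (Σℤ-cong (subsets E) (λ A → sumℤ-map-filter (vdisjoint A) (ξterm X minus1 Z A) (subsets E)))

    ξsummand-shared : ∀ {A B : Graph n} {e} → e ∈ A → e ∈ B → ξsummand A B ≡ + 0
    ξsummand-shared {A} {B} a b rewrite vd-shared-edge A B a b = refl

    open Weight {n} X (- Z)

    ξsummand-split : ∀ S {q} → q ∈ splits S → ξsummand (proj₁ q) (proj₂ q) ≡ (sign S * X ^ unc S) * weight (proj₁ q) (proj₂ q)
    ξsummand-split S {A , B} mq with vdisjoint A B in vd
    ... | false = sym (ℤP.*-zeroʳ (sign S * X ^ unc S))
    ... | true = begin
        X ^ (k (A ++ B) ∸ kcov B) * minus1 ^ ((length A ℕ.+ length B) ∸ kcov B) * Z ^ kcov B
      ≡⟨ cong₂ (λ s t → X ^ s * minus1 ^ t * Z ^ kcov B) x-exponent (cong (_∸ kcov B) lengths) ⟩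
        X ^ (unc S ℕ.+ kcov A) * minus1 ^ (length S ∸ kcov B) * Z ^ kcov B
      ≡⟨ ℤP.*-assoc (X ^ (unc S ℕ.+ kcov A)) _ _ ⟩
        X ^ (unc S ℕ.+ kcov A) * (minus1 ^ (length S ∸ kcov B) * Z ^ kcov B)
      ≡⟨ cong₂ _*_ (ℤP.^-distribˡ-+-* X (unc S) (kcov A)) (sign-shift (length S) (kcov B) Z kcov-B≤|S|) ⟩
        X ^ unc S * X ^ kcov A * (sign S * (- Z) ^ kcov B)
      ≡⟨ solve 4 (λ u a s w → u :* a :* (s :* w) := s :* u :* (a :* w)) refl (X ^ unc S) (X ^ kcov A) (sign S) ((- Z) ^ kcov B) ⟩
        sign S * X ^ unc S * (X ^ kcov A * (- Z) ^ kcov B) ∎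
      where
      open ≡-Reasoning
      open +-*-Solver
      open IsSplit (splits-sound S mq)
      A++B⊆S : (A ++ B) ⊆ S
      A++B⊆S m = [ A⊆X , B⊆X ]′ (∈-++⁻ A m)
      S⊆A++B : S ⊆ (A ++ B)
      S⊆A++B m = [ ∈-++⁺ˡ , ∈-++⁺ʳ A ]′ (X⊆A∪B m)
      x-exponent : k (A ++ B) ∸ kcov B ≡ unc S ℕ.+ kcov A
      x-exponent rewrite k-split (A ++ B) | unc-≈ A++B⊆S S⊆A++B | kcov-++ A B vd
                       | sym (ℕP.+-assoc (unc S) (kcov A) (kcov B)) = ℕP.m+n∸n≡m (unc S ℕ.+ kcov A) (kcov B)
      kcov-B≤|S| : kcov B ℕ.≤ length S
      kcov-B≤|S| = ℕP.≤-trans (kcov≤length B) (subst (length B ℕ.≤_) lengths (ℕP.m≤n+m (length B) (length A)))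

    Σsplits-ξsummand : ∀ (S : Graph n) → Σsplits ξsummand S ≡ sign S * X ^ unc S * (+ y) ^ kcov S
    Σsplits-ξsummand S = begin
        Σsplits ξsummand S
      ≡⟨ Σℤ-cong∈ (splits S) (ξsummand-split S) ⟩
        Σℤ (λ q → (sign S * X ^ unc S) * weight (proj₁ q) (proj₂ q)) (splits S)
      ≡⟨ Σℤ-*l (sign S * X ^ unc S) (λ q → weight (proj₁ q) (proj₂ q)) (splits S) ⟩
        (sign S * X ^ unc S) * Σsplits weight S
      ≡⟨ cong ((sign S * X ^ unc S) *_) (Σsplits-weight S) ⟩
        (sign S * X ^ unc S) * (X + - Z) ^ kcov S
      ≡⟨ cong (λ t → (sign S * X ^ unc S) * t ^ kcov S) (solve 2 (λ a b → a :+ :- (a :- b) := b) refl X (+ y)) ⟩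
        sign S * X ^ unc S * (+ y) ^ kcov S ∎
      where open ≡-Reasoning
            open +-*-Solver

    ξ-expansion : ∀ (E : Graph n) → ξ E X minus1 Z ≡ Σℤ (λ S → sign S * X ^ unc S * (+ y) ^ kcov S) (subsets E)
    ξ-expansion E = begin
        ξ E X minus1 Z
      ≡⟨ ξ-as-pairs E ⟩
        Σℤ (λ A → Σℤ (λ B → ξsummand A B) (subsets E)) (subsets E)
      ≡⟨ Σpairs≡Σsplits ξsummand ξsummand-shared E ⟩
        Σℤ (Σsplits ξsummand) (subsets E)
      ≡⟨ Σℤ-cong (subsets E) Σsplits-ξsummand ⟩
        Σℤ (λ S → sign S * X ^ unc S * (+ y) ^ kcov S) (subsets E) ∎
      where open ≡-Reasoning

open import Defs
open IntegerSums using (Σℤ)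
open ComponentCounts using (unc)
open Expansion using (P-expansion; sign; module XiExpansion)
open import Data.Nat using (ℕ; suc; _<_; s≤s)
open import Data.Nat.Properties using (m≤n⇒m≤1+n)
open import Data.Integer using (+_; -_; _-_; _*_; _^_)
open import Relation.Binary.PropositionalEquality using (_≡_; sym; module ≡-Reasoning)
open ≡-Reasoning

-- Both sides equal Σ_{S ⊆ E} (-1)^|S| x^unc(S) y^kcov(S).
proposition7 : (n : ℕ) (E : Graph n) (x y : ℕ) → 0 < y → y < x →
    + P E x y ≡ ξ E (+ x) (- (+ 1)) (+ x - + y)
proposition7 n E (suc x') y _ (s≤s y≤x') = begin
    + P E (suc x') y
  ≡⟨ P-expansion E x' y (m≤n⇒m≤1+n y≤x') ⟩
    Σℤ (λ S → sign S * (+ suc x') ^ unc S * (+ y) ^ kcov S) (subsets E)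
  ≡⟨ sym (XiExpansion.ξ-expansion (suc x') y E) ⟩
    ξ E (+ suc x') (- (+ 1)) (+ suc x' - + y) ∎
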